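{- Let $n\ge 6$, $r_n=0^{n-4}1011$, and let $\alpha\in\mathbf{A}(n)$ with $\alpha\neq r_n$. If neither $\mathrm{FirstOne}(\alpha)$ nor $\mathrm{LastOne}(\alpha)$ is in $\mathbf{A}(n)$, then the last $0$ in $\alpha$ is at index $n-2$ or $n-1$, and both $\mathrm{LastZero}(\alpha)$ and $\mathrm{LastOne}(\mathrm{LastZero}(\alpha))$ are in $\mathbf{A}(n)$.
   Context: Binary strings are compared lexicographically with $0<1$ (a proper prefix is smaller). For $\alpha=a_1\cdots a_n$, $\alpha^R=a_n\cdots a_1$. $[\alpha]$ is the set of rotations of $\alpha$; $\alpha$ is a necklace if it is lexicographically smallest in $[\alpha]$, and a bracelet if lexicographically smallest in $[\alpha]\cup[\alpha^R]$. A necklace $\alpha$ is symmetric if $\alpha^R\in[\alpha]$, otherwise asymmetric. $\mathbf{A}(n)$ is the set of length-$n$ asymmetric bracelets; every element begins with $0$ and ends with $1$. Indices are $1,\dots,n$. For $\alpha=a_1\cdots a_n$ beginning with $0$ and ending with $1$: $\mathrm{FirstOne}(\alpha)$ is $\alpha$ with its first $1$ flipped to $0$; $\mathrm{LastOne}(\alpha)$ is the necklace (lexicographically smallest rotation) of $a_1\cdots a_{n-1}0$; $\mathrm{LastZero}(\alpha)$ is $\alpha$ with its last $0$ flipped to $1$. -}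

module Defs where

open import Data.Bool using (Bool; true; false)
open import Data.Nat using (ℕ; zero; suc; _<_; _∸_)
open import Data.List using (List; []; _∷_; _++_; drop; take; reverse; length; replicate; foldr)
open import Data.List.Base using (upTo; map)
open import Data.Product using (Σ; _×_; ∃; ∃-syntax; _,_)
open import Data.Sum using (_⊎_)
open import Relation.Nullary using (¬_; yes; no)
open import Relation.Binary.PropositionalEquality using (_≡_)

-- Binary strings: false = 0, true = 1.
Str : Set
Str = List Bool

data _<ₗ_ : Str → Str → Set where
  []<∷  : ∀ {b β} → [] <ₗ (b ∷ β)
  0<1   : ∀ {α β} → (false ∷ α) <ₗ (true ∷ β)
  ∷<∷   : ∀ {b α β} → α <ₗ β → (b ∷ α) <ₗ (b ∷ β)

_≤ₗ_ : Str → Str → Set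
α ≤ₗ β = α <ₗ β ⊎ α ≡ β

rot : ℕ → Str → Str
rot k α = drop k α ++ take k α

IsNecklace : Str → Set
IsNecklace α = ∀ k → k < length α → α ≤ₗ rot k α

IsBracelet : Str → Set
IsBracelet α = IsNecklace α × (∀ k → k < length α → α ≤ₗ rot k (reverse α))

IsSymmetric : Str → Set
IsSymmetric α = ∃[ k ] (k < length α × reverse α ≡ rot k α)

InA : ℕ → Str → Set
InA n α = length α ≡ n × IsBracelet α × ¬ IsSymmetric α

lexLeq : Str → Str → Bool
lexLeq [] _ = true
lexLeq (_ ∷ _) [] = false
lexLeq (false ∷ α) (true ∷ β) = true
lexLeq (true ∷ α) (false ∷ β) = false
lexLeq (false ∷ α) (false ∷ β) = lexLeq α β
lexLeq (true ∷ α) (true ∷ β) = lexLeq α β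

lexMin : Str → Str → Str
lexMin α β with lexLeq α β
... | true = α
... | false = β

neck : Str → Str
neck α = foldr (λ k acc → lexMin (rot k α) acc) α (upTo (length α))

firstOne : Str → Str
firstOne [] = []
firstOne (false ∷ α) = false ∷ firstOne α
firstOne (true ∷ α) = false ∷ α

flipFirstZero : Str → Str
flipFirstZero [] = []
flipFirstZero (true ∷ α) = true ∷ flipFirstZero α
flipFirstZero (false ∷ α) = true ∷ α

lastZero : Str → Str
lastZero α = reverse (flipFirstZero (reverse α))

init : Str → Str
init [] = []
init (_ ∷ []) = []
init (a ∷ b ∷ α) = a ∷ init (b ∷ α)

lastOne : Str → Str
lastOne α = neck (init α ++ false ∷ [])

r : ℕ → Str
r n = replicate (n ∸ 4) false ++ true ∷ false ∷ true ∷ true ∷ []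

{-# OPTIONS --safe #-}
-- Write α = 0ᴶ 1 0ᵏ δ with δ = 1δ₁. The engine of the proof is that 0ᴹw is an asymmetric bracelet
-- whenever w begins and ends with 1, contains no run of M zeros and w < wᴿ. Since FirstOne(α) = 0ᴶ⁺ᵏ⁺¹δ
-- is not in A(n), δᴿ ≤ δ, which forces k ≥ 1; since LastOne(α) = 0ᴶ⁺¹w for α = 0ᴶw1 is not in A(n),
-- wᴿ ≤ w, which forbids α ending in 111. Hence α = v 0 1ᵗ with t ∈ {1, 2}. Raising this last 0 to 1
-- preserves minimality among rotations and strict minimality among reversed rotations, unless
-- v = P 1ᵃ (a < t) for a palindrome P; the run condition, α ≠ rₙ and a direct look at α = P 1011 rule
-- these out. Finally LastOne(LastZero α) = 0ᴶ⁺¹ 1v₁1ᵗ, whose comparison with its reversal is inherited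
-- from the comparison of α with its reversed rotation 0ᴶ 1ᵗ 0 (1v₁)ᴿ.
module Submission where

open import Defs
open import Data.Bool using (Bool; true; false)
open import Data.Nat using (ℕ; zero; suc; _+_; _∸_; _≤_; _<_; z≤n; s≤s; _≤?_)
open import Data.Nat.Properties using (<-irrefl; ≤-trans; m≤n⇒m⊓n≡m; m<n⇒m<1+n; n<1+n; suc-injective; +-comm; +-cancelˡ-≡; m≤m+n; m≤n+m; m+[n∸m]≡n; m+n∸n≡m; ≰⇒>)
open import Data.List using (List; []; _∷_; _++_; _∷ʳ_; initLast; InitLast; drop; take; reverse; length; replicate; foldr; upTo)
open import Data.List.Properties
  using (++-assoc; ++-identityʳ; ++-cancelˡ; ∷-injective; ∷-injectiveʳ; length-++; length-replicate;
         reverse-++; reverse-involutive; length-reverse; unfold-reverse; ∷ʳ-injective; ∷ʳ-injectiveʳ; take++drop≡id; length-take; ∷ʳ-++)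
open import Data.List.Membership.Propositional using (_∈_)
open import Data.List.Membership.Propositional.Properties using (∈-upTo⁺)
open import Data.List.Relation.Unary.Any using (here; there)
open import Data.Product using (_×_; ∃-syntax; _,_; proj₁; proj₂)
open import Data.Sum using (_⊎_; inj₁; inj₂) renaming (map to ⊎-map)
open import Data.Empty using (⊥; ⊥-elim)
open import Function using (_∘_)
open import Relation.Nullary using (¬_; yes; no)
open import Relation.Binary.PropositionalEquality using (_≡_; _≢_; refl; sym; trans; cong; cong₂; subst; subst₂; module ≡-Reasoning)

open InitLast

module _ {A : Set} where

  ++-≡-++ : ∀ (x y u v : List A) → x ++ y ≡ u ++ v →
            (∃[ s ] (x ≡ u ++ s × v ≡ s ++ y)) ⊎ (∃[ s ] (u ≡ x ++ s × y ≡ s ++ v))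
  ++-≡-++ []      y u       v e = inj₂ (u , refl , e)
  ++-≡-++ (a ∷ x) y []      v e = inj₁ (a ∷ x , refl , sym e)
  ++-≡-++ (a ∷ x) y (b ∷ u) v e with ∷-injective e
  ... | refl , e′ with ++-≡-++ x y u v e′
  ...   | inj₁ (s , p , q) = inj₁ (s , cong (a ∷_) p , q)
  ...   | inj₂ (s , p , q) = inj₂ (s , cong (a ∷_) p , q)

  ++-≡-++-sameLength : ∀ (a b : List A) {c d} → length a ≡ length b → a ++ c ≡ b ++ d → a ≡ b × c ≡ d
  ++-≡-++-sameLength []      []      _ e = refl , e
  ++-≡-++-sameLength (x ∷ a) (y ∷ b) l e with ∷-injective e
  ... | refl , e′ with ++-≡-++-sameLength a b (suc-injective l) e′
  ...   | refl , q = refl , q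

  length-∷ʳ : ∀ (xs : List A) x → length (xs ∷ʳ x) ≡ suc (length xs)
  length-∷ʳ xs x = trans (length-++ xs) (+-comm (length xs) 1)

  length-<-++-∷ : ∀ (x : List A) c y → length x < length (x ++ c ∷ y)
  length-<-++-∷ []      c y = s≤s z≤n
  length-<-++-∷ (a ∷ x) c y = s≤s (length-<-++-∷ x c y)

  reverse-∷ʳ : ∀ (xs : List A) x → reverse (xs ∷ʳ x) ≡ x ∷ reverse xs
  reverse-∷ʳ xs x = reverse-++ xs (x ∷ [])

  reverse-++-∷ : ∀ (xs : List A) x ys → reverse (xs ++ x ∷ ys) ≡ reverse ys ++ x ∷ reverse xs
  reverse-++-∷ xs x ys =
    trans (reverse-++ xs (x ∷ ys))
          (trans (cong (_++ reverse xs) (unfold-reverse x ys)) (++-assoc (reverse ys) (x ∷ []) (reverse xs)))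

  replicate-+ : ∀ a b (c : A) → replicate a c ++ replicate b c ≡ replicate (a + b) c
  replicate-+ zero    b c = refl
  replicate-+ (suc a) b c = cong (c ∷_) (replicate-+ a b c)

  replicate-++-comm : ∀ a b (c : A) → replicate a c ++ replicate b c ≡ replicate b c ++ replicate a c
  replicate-++-comm a b c =
    trans (replicate-+ a b c) (trans (cong (λ t → replicate t c) (+-comm a b)) (sym (replicate-+ b a c)))

  replicate-∷ʳ : ∀ a (c : A) → replicate a c ∷ʳ c ≡ c ∷ replicate a c
  replicate-∷ʳ a c = replicate-++-comm a 1 c

  replicate-++-∷ : ∀ a (c : A) s → replicate a c ++ c ∷ s ≡ c ∷ replicate a c ++ s
  replicate-++-∷ a c s = trans (sym (++-assoc (replicate a c) (c ∷ []) s)) (cong (_++ s) (replicate-∷ʳ a c))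

  reverse-replicate : ∀ a (c : A) → reverse (replicate a c) ≡ replicate a c
  reverse-replicate zero    c = refl
  reverse-replicate (suc a) c =
    trans (unfold-reverse c (replicate a c)) (trans (cong (_∷ʳ c) (reverse-replicate a c)) (replicate-∷ʳ a c))

  ++≡replicate⁻ : ∀ x s m (c : A) → x ++ s ≡ replicate m c →
                  x ≡ replicate (length x) c × s ≡ replicate (length s) c
  ++≡replicate⁻ []      s m       c e = refl , trans e (cong (λ t → replicate t c) (sym (trans (cong length e) (length-replicate m))))
  ++≡replicate⁻ (a ∷ x) s (suc m) c e with ∷-injective e
  ... | refl , e′ = cong (a ∷_) (proj₁ (++≡replicate⁻ x s m c e′)) , proj₂ (++≡replicate⁻ x s m c e′)

  ++≡replicate⇒comm : ∀ x s m (c : A) → x ++ s ≡ replicate m c → x ++ s ≡ s ++ x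
  ++≡replicate⇒comm x s m c e with ++≡replicate⁻ x s m c e
  ... | p , q = trans (cong₂ _++_ p q)
                      (trans (replicate-++-comm (length x) (length s) c) (sym (cong₂ _++_ q p)))

<ₗ-irrefl : ∀ {α} → ¬ α <ₗ α
<ₗ-irrefl (∷<∷ p) = <ₗ-irrefl p

<ₗ-trans : ∀ {α β γ} → α <ₗ β → β <ₗ γ → α <ₗ γ
<ₗ-trans []<∷    0<1     = []<∷
<ₗ-trans []<∷    (∷<∷ q) = []<∷
<ₗ-trans 0<1     (∷<∷ q) = 0<1
<ₗ-trans (∷<∷ p) 0<1     = 0<1
<ₗ-trans (∷<∷ p) (∷<∷ q) = ∷<∷ (<ₗ-trans p q)

<ₗ-≤ₗ-trans : ∀ {α β γ} → α <ₗ β → β ≤ₗ γ → α <ₗ γ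
<ₗ-≤ₗ-trans p (inj₁ q)    = <ₗ-trans p q
<ₗ-≤ₗ-trans p (inj₂ refl) = p

≤ₗ-<ₗ-trans : ∀ {α β γ} → α ≤ₗ β → β <ₗ γ → α <ₗ γ
≤ₗ-<ₗ-trans (inj₁ p)    q = <ₗ-trans p q
≤ₗ-<ₗ-trans (inj₂ refl) q = q

≤ₗ-trans : ∀ {α β γ} → α ≤ₗ β → β ≤ₗ γ → α ≤ₗ γ
≤ₗ-trans (inj₁ p)    q = inj₁ (<ₗ-≤ₗ-trans p q)
≤ₗ-trans (inj₂ refl) q = q

≤ₗ⇒≯ₗ : ∀ {α β} → α ≤ₗ β → ¬ β <ₗ α
≤ₗ⇒≯ₗ p q = <ₗ-irrefl (≤ₗ-<ₗ-trans p q)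

[]≤ₗ : ∀ α → [] ≤ₗ α
[]≤ₗ []      = inj₂ refl
[]≤ₗ (_ ∷ _) = inj₁ []<∷

<ₗ-++ˡ⁺ : ∀ p {u v} → u <ₗ v → (p ++ u) <ₗ (p ++ v)
<ₗ-++ˡ⁺ []      h = h
<ₗ-++ˡ⁺ (_ ∷ p) h = ∷<∷ (<ₗ-++ˡ⁺ p h)

≤ₗ-++ˡ⁺ : ∀ p {u v} → u ≤ₗ v → (p ++ u) ≤ₗ (p ++ v)
≤ₗ-++ˡ⁺ p (inj₁ h)    = inj₁ (<ₗ-++ˡ⁺ p h)
≤ₗ-++ˡ⁺ p (inj₂ refl) = inj₂ refl

<ₗ-++ˡ⁻ : ∀ p {u v} → (p ++ u) <ₗ (p ++ v) → u <ₗ v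
<ₗ-++ˡ⁻ []      h       = h
<ₗ-++ˡ⁻ (_ ∷ p) (∷<∷ h) = <ₗ-++ˡ⁻ p h

≤ₗ-++ˡ⁻ : ∀ p {u v} → (p ++ u) ≤ₗ (p ++ v) → u ≤ₗ v
≤ₗ-++ˡ⁻ p (inj₁ h) = inj₁ (<ₗ-++ˡ⁻ p h)
≤ₗ-++ˡ⁻ p (inj₂ e) = inj₂ (++-cancelˡ p _ _ e)

<ₗ-or-≥ₗ : ∀ α β → α <ₗ β ⊎ β ≤ₗ α
<ₗ-or-≥ₗ []          []          = inj₂ (inj₂ refl)
<ₗ-or-≥ₗ []          (_ ∷ _)     = inj₁ []<∷
<ₗ-or-≥ₗ (_ ∷ _)     []          = inj₂ (inj₁ []<∷)
<ₗ-or-≥ₗ (false ∷ α) (true ∷ β)  = inj₁ 0<1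
<ₗ-or-≥ₗ (true ∷ α)  (false ∷ β) = inj₂ (inj₁ 0<1)
<ₗ-or-≥ₗ (false ∷ α) (false ∷ β) = ⊎-map ∷<∷ (≤ₗ-++ˡ⁺ (false ∷ [])) (<ₗ-or-≥ₗ α β)
<ₗ-or-≥ₗ (true ∷ α)  (true ∷ β)  = ⊎-map ∷<∷ (≤ₗ-++ˡ⁺ (true ∷ [])) (<ₗ-or-≥ₗ α β)

<ₗ-++⁺ : ∀ {a b} c d → length a ≡ length b → a <ₗ b → (a ++ c) <ₗ (b ++ d)
<ₗ-++⁺ c d () []<∷
<ₗ-++⁺ c d _  0<1     = 0<1
<ₗ-++⁺ c d l  (∷<∷ h) = ∷<∷ (<ₗ-++⁺ c d (suc-injective l) h)

≤ₗ-++ʳ⁺ : ∀ {a b} c → length a ≡ length b → a ≤ₗ b → (a ++ c) ≤ₗ (b ++ c)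
≤ₗ-++ʳ⁺ c l (inj₁ p)    = inj₁ (<ₗ-++⁺ c c l p)
≤ₗ-++ʳ⁺ c l (inj₂ refl) = inj₂ refl

<ₗ-++⁻ : ∀ a b {c d} → length a ≡ length b → (a ++ c) <ₗ (b ++ d) → a <ₗ b ⊎ (a ≡ b × c <ₗ d)
<ₗ-++⁻ []          []          _ h = inj₂ (refl , h)
<ₗ-++⁻ (false ∷ a) (true ∷ b)  _ _ = inj₁ 0<1
<ₗ-++⁻ (true ∷ a)  (false ∷ b) _ ()
<ₗ-++⁻ (x ∷ a)     (.x ∷ b)    l (∷<∷ h) with <ₗ-++⁻ a b (suc-injective l) h
... | inj₁ p          = inj₁ (∷<∷ p)
... | inj₂ (refl , q) = inj₂ (refl , q)

≤ₗ-++⁻ : ∀ a b {c d} → length a ≡ length b → (a ++ c) ≤ₗ (b ++ d) → a <ₗ b ⊎ (a ≡ b × c ≤ₗ d)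
≤ₗ-++⁻ a b l (inj₁ h) with <ₗ-++⁻ a b l h
... | inj₁ p       = inj₁ p
... | inj₂ (e , q) = inj₂ (e , inj₁ q)
≤ₗ-++⁻ a b l (inj₂ h) with ++-≡-++-sameLength a b l h
... | e , q = inj₂ (e , inj₂ q)

<ₗ-++-cancelʳ : ∀ a b {c} → length a ≡ length b → (a ++ c) <ₗ (b ++ c) → a <ₗ b
<ₗ-++-cancelʳ a b l h with <ₗ-++⁻ a b l h
... | inj₁ p       = p
... | inj₂ (_ , q) = ⊥-elim (<ₗ-irrefl q)

zeros ones : ℕ → Str
zeros m = replicate m false
ones  m = replicate m true

zeros<ₗzeros++true : ∀ {b m} t r → b < m → (zeros m ++ t) <ₗ (zeros b ++ true ∷ r)
zeros<ₗzeros++true {zero}  {suc m} t r _         = 0<1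
zeros<ₗzeros++true {suc b} {suc m} t r (s≤s b<m) = ∷<∷ (zeros<ₗzeros++true t r b<m)

-- Rotations, necklaces and bracelets

RotationMinimal : Str → Set
RotationMinimal α = ∀ x y → x ++ y ≡ α → α ≤ₗ (y ++ x)

-- For an asymmetric bracelet the comparison with the rotations of the reversal is strict:
-- equality would make it symmetric.
StrictlyBelowReversal : Str → Set
StrictlyBelowReversal α = ∀ x y → x ++ y ≡ reverse α → α <ₗ (y ++ x)

rot-++ : ∀ (x y : Str) → rot (length x) (x ++ y) ≡ y ++ x
rot-++ x y = cong₂ _++_ (drop-++ x) (take-++ x)
  where
  drop-++ : ∀ x → drop (length x) (x ++ y) ≡ y
  drop-++ []      = refl
  drop-++ (a ∷ x) = drop-++ x
  take-++ : ∀ x → take (length x) (x ++ y) ≡ x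
  take-++ []      = refl
  take-++ (a ∷ x) = cong (a ∷_) (take-++ x)

IsNecklace⇒RotationMinimal : ∀ {α} → IsNecklace α → RotationMinimal α
IsNecklace⇒RotationMinimal {α} nk x []      e = inj₂ (trans (sym e) (++-identityʳ x))
IsNecklace⇒RotationMinimal {α} nk x (c ∷ y) refl =
  subst ((x ++ c ∷ y) ≤ₗ_) (rot-++ x (c ∷ y)) (nk (length x) (length-<-++-∷ x c y))

reversal-rotation⇒IsSymmetric : ∀ {α} → 0 < length α → ∀ x y → x ++ y ≡ reverse α → α ≡ y ++ x → IsSymmetric α
reversal-rotation⇒IsSymmetric {α} pos [] y e q =
  0 , pos , trans (sym e) (trans (sym (++-identityʳ y)) (trans (sym q) (sym (++-identityʳ α))))
reversal-rotation⇒IsSymmetric {α} pos (c ∷ x) [] e q =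
  0 , pos , trans (sym e) (trans (++-identityʳ (c ∷ x)) (trans (sym q) (sym (++-identityʳ α))))
reversal-rotation⇒IsSymmetric {α} pos (c ∷ x) (d ∷ y) e refl =
  length (d ∷ y) , length-<-++-∷ (d ∷ y) c x , trans (sym e) (sym (rot-++ (d ∷ y) (c ∷ x)))

InA⇒RotationMinimal : ∀ {n α} → InA n α → RotationMinimal α
InA⇒RotationMinimal (_ , (nk , _) , _) = IsNecklace⇒RotationMinimal nk

InA⇒StrictlyBelowReversal : ∀ {n α} → 0 < length α → InA n α → StrictlyBelowReversal α
InA⇒StrictlyBelowReversal {n} {α} pos (_ , (_ , br) , asym) x y e with reversal≤ x y e
  where
  reversal≤ : ∀ x y → x ++ y ≡ reverse α → α ≤ₗ (y ++ x)
  reversal≤ x [] e =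
    subst (α ≤ₗ_) (trans (++-identityʳ (reverse α)) (trans (sym e) (++-identityʳ x))) (br 0 pos)
  reversal≤ x (c ∷ y) e =
    subst (α ≤ₗ_) (trans (cong (rot (length x)) (sym e)) (rot-++ x (c ∷ y)))
      (br (length x) (subst (length x <_) (trans (cong length e) (length-reverse α)) (length-<-++-∷ x c y)))
... | inj₁ p = p
... | inj₂ q = ⊥-elim (asym (reversal-rotation⇒IsSymmetric pos x y e q))

InA-intro : ∀ {n α} → length α ≡ n → RotationMinimal α → StrictlyBelowReversal α → InA n α
InA-intro {n} {α} l nk sb = l , (necklace , bracelet) , asymmetric
  where
  necklace : IsNecklace α
  necklace k _ = nk (take k α) (drop k α) (take++drop≡id k α)
  bracelet : ∀ k → k < length α → α ≤ₗ rot k (reverse α)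
  bracelet k _ = inj₁ (sb (take k (reverse α)) (drop k (reverse α)) (take++drop≡id k (reverse α)))
  asymmetric : ¬ IsSymmetric α
  asymmetric (k , _ , e) = <ₗ-irrefl (subst (α <ₗ_) (take++drop≡id k α) (sb (drop k α) (take k α) (sym e)))

Rotation : Str → Str → Set
Rotation ζ η = ∃[ x ] ∃[ y ] (x ++ y ≡ ζ × y ++ x ≡ η)

Rotation-refl : ∀ ζ → Rotation ζ ζ
Rotation-refl ζ = [] , ζ , refl , ++-identityʳ ζ

Rotation-sym : ∀ {ζ η} → Rotation ζ η → Rotation η ζ
Rotation-sym (x , y , p , q) = y , x , q , p

Rotation-trans : ∀ {ζ η θ} → Rotation ζ η → Rotation η θ → Rotation ζ θ
Rotation-trans (x , y , refl , refl) (u , v , e , refl) with ++-≡-++ u v y x e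
... | inj₁ (s , refl , refl) = s , v ++ y , sym (++-assoc s v y) , ++-assoc v y s
... | inj₂ (s , refl , refl) = x ++ u , s , ++-assoc x u s , sym (++-assoc s x u)

rot-Rotation : ∀ k ζ → Rotation ζ (rot k ζ)
rot-Rotation k ζ = take k ζ , drop k ζ , take++drop≡id k ζ , refl

lexLeq⇒≤ₗ : ∀ a b → lexLeq a b ≡ true → a ≤ₗ b
lexLeq⇒≤ₗ []          b           _ = []≤ₗ b
lexLeq⇒≤ₗ (false ∷ a) (true ∷ b)  _ = inj₁ 0<1
lexLeq⇒≤ₗ (false ∷ a) (false ∷ b) e = ≤ₗ-++ˡ⁺ (false ∷ []) (lexLeq⇒≤ₗ a b e)
lexLeq⇒≤ₗ (true ∷ a)  (true ∷ b)  e = ≤ₗ-++ˡ⁺ (true ∷ []) (lexLeq⇒≤ₗ a b e)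

lexLeq≡false⇒>ₗ : ∀ a b → lexLeq a b ≡ false → b <ₗ a
lexLeq≡false⇒>ₗ (_ ∷ a)     []          _ = []<∷
lexLeq≡false⇒>ₗ (true ∷ a)  (false ∷ b) _ = 0<1
lexLeq≡false⇒>ₗ (false ∷ a) (false ∷ b) e = ∷<∷ (lexLeq≡false⇒>ₗ a b e)
lexLeq≡false⇒>ₗ (true ∷ a)  (true ∷ b)  e = ∷<∷ (lexLeq≡false⇒>ₗ a b e)

lexMin-sel : ∀ a b → lexMin a b ≡ a ⊎ lexMin a b ≡ b
lexMin-sel a b with lexLeq a b
... | true  = inj₁ refl
... | false = inj₂ refl

lexMin-≤ₗˡ : ∀ a b → lexMin a b ≤ₗ a
lexMin-≤ₗˡ a b with lexLeq a b in eq
... | true  = inj₂ refl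
... | false = inj₁ (lexLeq≡false⇒>ₗ a b eq)

lexMin-≤ₗʳ : ∀ a b → lexMin a b ≤ₗ b
lexMin-≤ₗʳ a b with lexLeq a b in eq
... | true  = lexLeq⇒≤ₗ a b eq
... | false = inj₂ refl

module _ (ζ : Str) where

  private
    minRot : List ℕ → Str
    minRot = foldr (λ k acc → lexMin (rot k ζ) acc) ζ

    minRot-Rotation : ∀ ks → Rotation ζ (minRot ks)
    minRot-Rotation []       = Rotation-refl ζ
    minRot-Rotation (k ∷ ks) with lexMin-sel (rot k ζ) (minRot ks)
    ... | inj₁ e = subst (Rotation ζ) (sym e) (rot-Rotation k ζ)
    ... | inj₂ e = subst (Rotation ζ) (sym e) (minRot-Rotation ks)

    minRot-≤ₗ : ∀ ks → minRot ks ≤ₗ ζ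
    minRot-≤ₗ []       = inj₂ refl
    minRot-≤ₗ (k ∷ ks) = ≤ₗ-trans (lexMin-≤ₗʳ (rot k ζ) (minRot ks)) (minRot-≤ₗ ks)

    minRot-≤ₗ-rot : ∀ ks {k} → k ∈ ks → minRot ks ≤ₗ rot k ζ
    minRot-≤ₗ-rot (k ∷ ks)  (here refl) = lexMin-≤ₗˡ (rot k ζ) (minRot ks)
    minRot-≤ₗ-rot (k′ ∷ ks) (there k∈) = ≤ₗ-trans (lexMin-≤ₗʳ (rot k′ ζ) (minRot ks)) (minRot-≤ₗ-rot ks k∈)

  neck-Rotation : Rotation ζ (neck ζ)
  neck-Rotation = minRot-Rotation (upTo (length ζ))

  neck-≤ₗ : ∀ {η} → Rotation ζ η → neck ζ ≤ₗ η
  neck-≤ₗ (x , [] , refl , refl) =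
    subst (neck (x ++ []) ≤ₗ_) (++-identityʳ x) (minRot-≤ₗ (upTo (length (x ++ []))))
  neck-≤ₗ (x , c ∷ y , refl , refl) =
    subst (neck (x ++ c ∷ y) ≤ₗ_) (rot-++ x (c ∷ y))
      (minRot-≤ₗ-rot (upTo (length (x ++ c ∷ y))) (∈-upTo⁺ (length-<-++-∷ x c y)))

neck-unique : ∀ {ζ η} → RotationMinimal η → Rotation ζ η → neck ζ ≡ η
neck-unique {ζ} {η} min r with neck-≤ₗ ζ r
... | inj₂ e = e
... | inj₁ p with Rotation-trans (Rotation-sym r) (neck-Rotation ζ)
...   | x , y , e , q = ⊥-elim (≤ₗ⇒≯ₗ (subst (η ≤ₗ_) q (min x y e)) p)

-- Runs of zeros and the bracelets 0ᴹw

Starts1 Ends1 : Str → Set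
Starts1 s = ∃[ s′ ] s ≡ true ∷ s′
Ends1   s = ∃[ s′ ] s ≡ s′ ∷ʳ true

Ends1-++⁻ʳ : ∀ s c y → Ends1 (s ++ c ∷ y) → Ends1 (c ∷ y)
Ends1-++⁻ʳ s c y (d , e) with ++-≡-++ s (c ∷ y) d (true ∷ []) e
... | inj₂ (s₂ , _ , q)     = s₂ , q
... | inj₁ ([] , _ , q)     = [] , sym q
... | inj₁ (_ ∷ [] , _ , ())
... | inj₁ (_ ∷ _ ∷ _ , _ , ())

Starts1⇒reverse-Ends1 : ∀ {s} → Starts1 s → Ends1 (reverse s)
Starts1⇒reverse-Ends1 (s′ , refl) = reverse s′ , unfold-reverse true s′

Ends1⇒reverse-Starts1 : ∀ {s} → Ends1 s → Starts1 (reverse s)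
Ends1⇒reverse-Starts1 (s′ , refl) = reverse s′ , reverse-∷ʳ s′ true

zeros≢∷ʳtrue : ∀ b s → zeros b ≢ s ∷ʳ true
zeros≢∷ʳtrue zero    []      ()
zeros≢∷ʳtrue zero    (_ ∷ _) ()
zeros≢∷ʳtrue (suc b) []      ()
zeros≢∷ʳtrue (suc b) (_ ∷ s) e = zeros≢∷ʳtrue b s (∷-injectiveʳ e)

zeros-split : ∀ s → (∃[ b ] s ≡ zeros b) ⊎ (∃[ b ] ∃[ r ] s ≡ zeros b ++ true ∷ r)
zeros-split []          = inj₁ (0 , refl)
zeros-split (true ∷ s)  = inj₂ (0 , s , refl)
zeros-split (false ∷ s) with zeros-split s
... | inj₁ (b , e)     = inj₁ (suc b , cong (false ∷_) e)
... | inj₂ (b , r , e) = inj₂ (suc b , r , cong (false ∷_) e)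

zeros-++-split : ∀ {m b} → m ≤ b → ∀ s → zeros b ++ s ≡ zeros m ++ zeros (b ∸ m) ++ s
zeros-++-split {m} {b} m≤b s =
  trans (cong (λ t → zeros t ++ s) (sym (m+[n∸m]≡n m≤b)))
        (trans (cong (_++ s) (sym (replicate-+ m (b ∸ m) false))) (++-assoc (zeros m) (zeros (b ∸ m)) s))

NoZeroRun : ℕ → Str → Set
NoZeroRun m w = ∀ u v → w ≢ u ++ zeros m ++ v

NoZeroRun-++⁻ʳ : ∀ {m} s y → NoZeroRun m (s ++ y) → NoZeroRun m y
NoZeroRun-++⁻ʳ s y h u v e = h (s ++ u) v (trans (cong (s ++_) e) (sym (++-assoc s u _)))

NoZeroRun-++⁻ˡ : ∀ {m} y s → NoZeroRun m (y ++ s) → NoZeroRun m y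
NoZeroRun-++⁻ˡ {m} y s h u v e =
  h u (v ++ s) (trans (cong (_++ s) e) (trans (++-assoc u _ s) (cong (u ++_) (++-assoc (zeros m) v s))))

NoZeroRun-infix : ∀ {m} a w b → NoZeroRun m (a ++ w ++ b) → NoZeroRun m w
NoZeroRun-infix a w b h = NoZeroRun-++⁻ˡ w b (NoZeroRun-++⁻ʳ a (w ++ b) h)

NoZeroRun-reverse : ∀ {m} w → NoZeroRun m w → NoZeroRun m (reverse w)
NoZeroRun-reverse {m} w h u v e = h (reverse v) (reverse u) (begin
  w                                   ≡⟨ sym (reverse-involutive w) ⟩
  reverse (reverse w)                 ≡⟨ cong reverse e ⟩
  reverse (u ++ zeros m ++ v)         ≡⟨ reverse-++ u (zeros m ++ v) ⟩
  reverse (zeros m ++ v) ++ reverse u ≡⟨ cong (_++ reverse u) (reverse-++ (zeros m) v) ⟩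
  (reverse v ++ reverse (zeros m)) ++ reverse u
                                      ≡⟨ cong (λ t → (reverse v ++ t) ++ reverse u) (reverse-replicate m false) ⟩
  (reverse v ++ zeros m) ++ reverse u ≡⟨ ++-assoc (reverse v) (zeros m) (reverse u) ⟩
  reverse v ++ zeros m ++ reverse u   ∎)
  where open ≡-Reasoning

NoZeroRun-mono : ∀ {m m′} w → m ≤ m′ → NoZeroRun m w → NoZeroRun m′ w
NoZeroRun-mono {m} {m′} w m≤m′ h u v e = h u (zeros (m′ ∸ m) ++ v) (trans e (cong (u ++_) (zeros-++-split m≤m′ v)))

NoZeroRun-true∷ : ∀ {m} s → NoZeroRun (suc m) s → NoZeroRun (suc m) (true ∷ s)
NoZeroRun-true∷ s h []      v ()
NoZeroRun-true∷ s h (_ ∷ u) v e = h u v (∷-injectiveʳ e)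

NoZeroRun-∷ʳtrue : ∀ {m} s → NoZeroRun (suc m) s → NoZeroRun (suc m) (s ∷ʳ true)
NoZeroRun-∷ʳtrue {m} s h =
  subst (NoZeroRun (suc m)) (trans (unfold-reverse true (reverse s)) (cong (_∷ʳ true) (reverse-involutive s)))
        (NoZeroRun-reverse (true ∷ reverse s) (NoZeroRun-true∷ (reverse s) (NoZeroRun-reverse s h)))

NoZeroRun-++ones : ∀ {m} e s → NoZeroRun (suc m) s → NoZeroRun (suc m) (s ++ ones e)
NoZeroRun-++ones {m} zero    s h = subst (NoZeroRun (suc m)) (sym (++-identityʳ s)) h
NoZeroRun-++ones {m} (suc e) s h =
  subst (NoZeroRun (suc m)) (++-assoc s (true ∷ []) (ones e)) (NoZeroRun-++ones e (s ∷ʳ true) (NoZeroRun-∷ʳtrue s h))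

NoZeroRun⇒zeros++true : ∀ {m s} → NoZeroRun m s → Ends1 s → ∃[ b ] ∃[ r ] (b < m × s ≡ zeros b ++ true ∷ r)
NoZeroRun⇒zeros++true {m} {s} h (s′ , es) with zeros-split s
... | inj₁ (b , e) = ⊥-elim (zeros≢∷ʳtrue b s′ (trans (sym e) es))
... | inj₂ (b , r , e) with m ≤? b
...   | no  m≰b = b , r , ≰⇒> m≰b , e
...   | yes m≤b = ⊥-elim (h [] (zeros (b ∸ m) ++ true ∷ r) (trans e (zeros-++-split m≤b (true ∷ r))))

zeros<ₗrunFree : ∀ {M} w y x → NoZeroRun M y → Ends1 y → (zeros M ++ w) <ₗ (y ++ x)
zeros<ₗrunFree {M} w y x h en with NoZeroRun⇒zeros++true h en
... | b , r , b<M , refl =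
  subst ((zeros M ++ w) <ₗ_) (sym (++-assoc (zeros b) _ x)) (zeros<ₗzeros++true w (r ++ x) b<M)

-- The leading block of M zeros is the only run of M zeros, so every rotation that does not start
-- with it begins with fewer zeros followed by a 1; what remains is the comparison of w with its reversal.
module _ {m w} (noRun : NoZeroRun (suc m) w) (w-starts : Starts1 w) (w-ends : Ends1 w) where

  private
    M : ℕ
    M = suc m

    zerosᴹ-comm : ∀ x s → x ++ s ≡ zeros M → x ++ s ≡ s ++ x
    zerosᴹ-comm x s = ++≡replicate⇒comm x s M false

    zeros<ₗsuffix : ∀ u s c y x → s ++ c ∷ y ≡ u → NoZeroRun M u → Ends1 u → (zeros M ++ w) <ₗ ((c ∷ y) ++ x)
    zeros<ₗsuffix u s c y x refl nr en =
      zeros<ₗrunFree w (c ∷ y) x (NoZeroRun-++⁻ʳ s (c ∷ y) nr) (Ends1-++⁻ʳ s c y en)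

  zeros++-RotationMinimal : RotationMinimal (zeros M ++ w)
  zeros++-RotationMinimal x y e with ++-≡-++ x y (zeros M) w e
  ... | inj₁ (s , refl , q) = afterBlock y q
    where
    afterBlock : ∀ y → w ≡ s ++ y → (zeros M ++ w) ≤ₗ (y ++ zeros M ++ s)
    afterBlock []       q = inj₂ (cong (zeros M ++_) (trans q (++-identityʳ s)))
    afterBlock (c ∷ y′) q = inj₁ (zeros<ₗsuffix w s c y′ _ (sym q) noRun w-ends)
  ... | inj₂ (s , p , q) = insideBlock x p
    where
    insideBlock : ∀ x → zeros M ≡ x ++ s → (zeros M ++ w) ≤ₗ (y ++ x)
    insideBlock []       p = inj₂ (sym (trans (++-identityʳ y) (trans q (cong (_++ w) (sym p)))))
    insideBlock (c ∷ x′) p with ∷-injective p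
    ... | refl , _ = inj₁ (subst₂ _<ₗ_ η≡ rot≡ (<ₗ-++ˡ⁺ s x′w<wx′))
      where
      x′w<wx′ : (false ∷ x′ ++ w) <ₗ (w ++ false ∷ x′)
      x′w<wx′ = subst (λ t → (false ∷ x′ ++ w) <ₗ (t ++ false ∷ x′)) (sym (proj₂ w-starts)) 0<1
      η≡ : s ++ (false ∷ x′) ++ w ≡ zeros M ++ w
      η≡ = trans (sym (++-assoc s (false ∷ x′) w)) (cong (_++ w) (trans (sym (zerosᴹ-comm (false ∷ x′) s (sym p))) (sym p)))
      rot≡ : s ++ w ++ false ∷ x′ ≡ y ++ false ∷ x′
      rot≡ = trans (sym (++-assoc s w (false ∷ x′))) (cong (_++ false ∷ x′) (sym q))

  zeros++-StrictlyBelowReversal : w <ₗ reverse w → StrictlyBelowReversal (zeros M ++ w)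
  zeros++-StrictlyBelowReversal w<wᴿ x y e with ++-≡-++ x y (reverse w) (zeros M) (trans e reverse-η)
    where
    reverse-η : reverse (zeros M ++ w) ≡ reverse w ++ zeros M
    reverse-η = trans (reverse-++ (zeros M) w) (cong (reverse w ++_) (reverse-replicate M false))
  ... | inj₁ (s , refl , q) = subst (_<ₗ (y ++ reverse w ++ s)) η≡ (<ₗ-++ˡ⁺ y (tail< s q))
    where
    η≡ : y ++ s ++ w ≡ zeros M ++ w
    η≡ = trans (sym (++-assoc y s w)) (cong (_++ w) (trans (sym (zerosᴹ-comm s y (sym q))) (sym q)))
    tail< : ∀ s → zeros M ≡ s ++ y → (s ++ w) <ₗ (reverse w ++ s)
    tail< []       _ = subst (w <ₗ_) (sym (++-identityʳ (reverse w))) w<wᴿ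
    tail< (c ∷ s′) q with ∷-injective q | Ends1⇒reverse-Starts1 w-ends
    ... | refl , _ | _ , e₁ = subst (λ t → (false ∷ s′ ++ w) <ₗ (t ++ false ∷ s′)) (sym e₁) 0<1
  ... | inj₂ ([] , p , refl) =
    subst (λ t → (zeros M ++ w) <ₗ (zeros M ++ t)) (trans p (++-identityʳ x)) (<ₗ-++ˡ⁺ (zeros M) w<wᴿ)
  ... | inj₂ (c ∷ s , p , refl) =
    subst ((zeros M ++ w) <ₗ_) (sym (++-assoc (c ∷ s) (zeros M) x))
      (zeros<ₗsuffix (reverse w) x c s (zeros M ++ x) (sym p) (NoZeroRun-reverse w noRun) (Starts1⇒reverse-Ends1 w-starts))

zeros++-InA : ∀ {n m w} → length (zeros (suc m) ++ w) ≡ n → NoZeroRun (suc m) w → Starts1 w → Ends1 w →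
              w <ₗ reverse w → InA n (zeros (suc m) ++ w)
zeros++-InA l nr st en lt = InA-intro l (zeros++-RotationMinimal nr st en) (zeros++-StrictlyBelowReversal nr st en lt)

∷ʳfalse≤ₗfalse∷⇒zeros : ∀ s → (s ∷ʳ false) ≤ₗ (false ∷ s) → s ≡ zeros (length s)
∷ʳfalse≤ₗfalse∷⇒zeros []          _       = refl
∷ʳfalse≤ₗfalse∷⇒zeros (true ∷ s)  (inj₁ ())
∷ʳfalse≤ₗfalse∷⇒zeros (true ∷ s)  (inj₂ ())
∷ʳfalse≤ₗfalse∷⇒zeros (false ∷ s) h = cong (false ∷_) (∷ʳfalse≤ₗfalse∷⇒zeros s (≤ₗ-++ˡ⁻ (false ∷ []) h))

true∷≤ₗ∷ʳtrue⇒ones : ∀ s → (true ∷ s) ≤ₗ (s ∷ʳ true) → s ≡ ones (length s)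
true∷≤ₗ∷ʳtrue⇒ones []          _        = refl
true∷≤ₗ∷ʳtrue⇒ones (false ∷ s) (inj₁ ())
true∷≤ₗ∷ʳtrue⇒ones (false ∷ s) (inj₂ ())
true∷≤ₗ∷ʳtrue⇒ones (true ∷ s)  h = cong (true ∷_) (true∷≤ₗ∷ʳtrue⇒ones s (≤ₗ-++ˡ⁻ (true ∷ []) h))

-- If s ≥ sᴿ then s0 < 0sᴿ ≤ 0s, which forces s to be all zeros, and then s0 = 0s.
∷ʳfalse<ₗfalse∷reverse⇒<ₗreverse : ∀ s → (s ∷ʳ false) <ₗ (false ∷ reverse s) → s <ₗ reverse s
∷ʳfalse<ₗfalse∷reverse⇒<ₗreverse s h with <ₗ-or-≥ₗ s (reverse s)
... | inj₁ s<sᴿ = s<sᴿ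
... | inj₂ sᴿ≤s = ⊥-elim (<ₗ-irrefl (subst (_<ₗ (false ∷ s)) s0≡0s s0<0s))
  where
  s0<0s : (s ∷ʳ false) <ₗ (false ∷ s)
  s0<0s = <ₗ-≤ₗ-trans h (≤ₗ-++ˡ⁺ (false ∷ []) sᴿ≤s)
  s≡zeros : s ≡ zeros (length s)
  s≡zeros = ∷ʳfalse≤ₗfalse∷⇒zeros s (inj₁ s0<0s)
  s0≡0s : s ∷ʳ false ≡ false ∷ s
  s0≡0s = trans (cong (_∷ʳ false) s≡zeros) (trans (replicate-∷ʳ (length s) false) (cong (false ∷_) (sym s≡zeros)))

data OnesPrefix (m : ℕ) : Str → Set where
  full  : ∀ y → OnesPrefix m (ones m ++ y)
  short : ∀ {a} y → a < m → OnesPrefix m (ones a ++ false ∷ y)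
  only  : ∀ {a} → a < m → OnesPrefix m (ones a)

onesPrefix : ∀ m u → OnesPrefix m u
onesPrefix zero    u           = full u
onesPrefix (suc m) []          = only (s≤s z≤n)
onesPrefix (suc m) (false ∷ u) = short u (s≤s z≤n)
onesPrefix (suc m) (true ∷ u) with onesPrefix m u
... | full y      = full y
... | short y a<m = short y (s≤s a<m)
... | only a<m    = only (s≤s a<m)

ones++false<ₗones++ : ∀ {a b} x y → a < b → (ones a ++ false ∷ x) <ₗ (ones b ++ y)
ones++false<ₗones++ {zero}  {suc b} x y _         = 0<1
ones++false<ₗones++ {suc a} {suc b} x y (s≤s a<b) = ∷<∷ (ones++false<ₗones++ x y a<b)

ones≮ₗ : ∀ a w → length w ≡ a → ¬ ones a <ₗ w
ones≮ₗ zero    []          _ ()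
ones≮ₗ (suc a) (true ∷ w)  l (∷<∷ h) = ones≮ₗ a w (suc-injective l) h

module _ (m : ℕ) where

  private
    short<ₗ : ∀ {a b} y z t → a < b → ((ones a ++ false ∷ y) ++ z) <ₗ (ones b ++ t)
    short<ₗ {a} {b} y z t a<m =
      subst (_<ₗ (ones b ++ t)) (sym (++-assoc (ones a) (false ∷ y) z)) (ones++false<ₗones++ (y ++ z) t a<m)

    reverse-ones++ : ∀ y → reverse (ones m ++ y) ≡ reverse y ++ ones m
    reverse-ones++ y = trans (reverse-++ (ones m) y) (cong (reverse y ++_) (reverse-replicate m true))

  -- The hypothesis is what an asymmetric bracelet 0ʲ u 0 1ᵐ says about its reversed rotation 0ʲ 1ᵐ 0 uᴿ.
  ones-shift-<ₗ : ∀ u → (∀ {a} → a < m → u ≢ ones a) →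
                  (u ++ false ∷ ones m) <ₗ (ones m ++ false ∷ reverse u) → (u ++ ones m) <ₗ (ones m ++ reverse u)
  ones-shift-<ₗ u notOnes h with onesPrefix m u
  ... | only a<m    = ⊥-elim (notOnes a<m refl)
  ... | short {a} y a<m = short<ₗ y (ones m) (reverse (ones a ++ false ∷ y)) a<m
  ... | full y      = subst₂ _<ₗ_ (sym (++-assoc (ones m) y (ones m))) (cong (ones m ++_) (sym (reverse-ones++ y)))
                        (<ₗ-++ˡ⁺ (ones m) (<ₗ-++⁺ (ones m) (ones m) (sym (length-reverse y)) y<yᴿ))
    where
    y0<0yᴿ : (y ∷ʳ false) <ₗ (false ∷ reverse y)
    y0<0yᴿ = <ₗ-++-cancelʳ (y ∷ʳ false) (false ∷ reverse y)
               (trans (length-∷ʳ y false) (cong suc (sym (length-reverse y))))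
               (<ₗ-++ˡ⁻ (ones m) (subst₂ _<ₗ_
                  (trans (++-assoc (ones m) y (false ∷ ones m)) (cong (ones m ++_) (sym (++-assoc y (false ∷ []) (ones m)))))
                  (cong (λ t → ones m ++ false ∷ t) (reverse-ones++ y)) h))
    y<yᴿ : y <ₗ reverse y
    y<yᴿ = ∷ʳfalse<ₗfalse∷reverse⇒<ₗreverse y y0<0yᴿ

  ones-raise-<ₗ : ∀ R w → length R ≡ length w → (∀ {a} → a < m → R ≢ ones a) →
                  (R ++ false ∷ ones m) <ₗ (ones m ++ false ∷ w) → (R ++ ones (suc m)) <ₗ (ones (suc m) ++ w)
  ones-raise-<ₗ R w l notOnes h with onesPrefix m R
  ... | only a<m    = ⊥-elim (notOnes a<m refl)
  ... | short y a<m = short<ₗ y (ones (suc m)) w (m<n⇒m<1+n a<m)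
  ... | full y      = tail y (<ₗ-++ˡ⁻ (ones m) (subst (_<ₗ (ones m ++ false ∷ w)) (++-assoc (ones m) y _) h)) refl
    where
    tail : ∀ y′ → (y′ ++ false ∷ ones m) <ₗ (false ∷ w) → y′ ≡ y → ((ones m ++ y) ++ ones (suc m)) <ₗ (ones (suc m) ++ w)
    tail []          (∷<∷ h′) refl = ⊥-elim (ones≮ₗ m w |w|≡m h′)
      where
      |w|≡m : length w ≡ m
      |w|≡m = trans (sym l) (trans (cong length (++-identityʳ (ones m))) (length-replicate m))
    tail (false ∷ y′) _ refl = short<ₗ y′ (ones (suc m)) w (n<1+n m)

firstOne-zeros : ∀ a ρ → firstOne (zeros a ++ true ∷ ρ) ≡ zeros (suc a) ++ ρ
firstOne-zeros zero    ρ = refl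
firstOne-zeros (suc a) ρ = cong (false ∷_) (firstOne-zeros a ρ)

length-firstOne : ∀ α → length (firstOne α) ≡ length α
length-firstOne []          = refl
length-firstOne (false ∷ α) = cong suc (length-firstOne α)
length-firstOne (true ∷ α)  = refl

lastZero-++ones : ∀ β e → lastZero (β ++ false ∷ ones e) ≡ β ++ true ∷ ones e
lastZero-++ones β e = begin
  reverse (flipFirstZero (reverse (β ++ false ∷ ones e)))
    ≡⟨ cong (reverse ∘ flipFirstZero) (reverse-++-∷ β false (ones e)) ⟩
  reverse (flipFirstZero (reverse (ones e) ++ false ∷ reverse β))
    ≡⟨ cong (λ t → reverse (flipFirstZero (t ++ false ∷ reverse β))) (reverse-replicate e true) ⟩
  reverse (flipFirstZero (ones e ++ false ∷ reverse β))
    ≡⟨ cong reverse (flipFirstZero-ones e (reverse β)) ⟩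
  reverse (ones e ++ true ∷ reverse β)
    ≡⟨ reverse-++-∷ (ones e) true (reverse β) ⟩
  reverse (reverse β) ++ true ∷ reverse (ones e)
    ≡⟨ cong₂ (λ a b → a ++ true ∷ b) (reverse-involutive β) (reverse-replicate e true) ⟩
  β ++ true ∷ ones e ∎
  where
  open ≡-Reasoning
  flipFirstZero-ones : ∀ e s → flipFirstZero (ones e ++ false ∷ s) ≡ ones e ++ true ∷ s
  flipFirstZero-ones zero    s = refl
  flipFirstZero-ones (suc e) s = cong (true ∷_) (flipFirstZero-ones e s)

init-∷ʳ : ∀ P (c : Bool) → init (P ∷ʳ c) ≡ P
init-∷ʳ []          c = refl
init-∷ʳ (a ∷ [])    c = refl
init-∷ʳ (a ∷ b ∷ P) c = cong (a ∷_) (init-∷ʳ (b ∷ P) c)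

lastOne-∷ʳtrue : ∀ P → RotationMinimal (false ∷ P) → lastOne (P ∷ʳ true) ≡ false ∷ P
lastOne-∷ʳtrue P min =
  trans (cong (λ t → neck (t ∷ʳ false)) (init-∷ʳ P true)) (neck-unique min (P , false ∷ [] , refl , refl))

lastOne-InA : ∀ {n m P w} → length (P ∷ʳ true) ≡ n → false ∷ P ≡ zeros (suc m) ++ w →
              NoZeroRun (suc m) w → Starts1 w → Ends1 w → w <ₗ reverse w → InA n (lastOne (P ∷ʳ true))
lastOne-InA {n} {m} {P} {w} l e nr st en lt =
  subst (InA n) (sym (trans (lastOne-∷ʳtrue P (subst RotationMinimal (sym e) (zeros++-RotationMinimal nr st en))) e))
    (zeros++-InA (trans (cong length (sym e)) (trans (sym (length-∷ʳ P true)) l)) nr st en lt)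

∷ʳfalse<ₗ∷ʳtrue : ∀ s → (s ∷ʳ false) <ₗ (s ∷ʳ true)
∷ʳfalse<ₗ∷ʳtrue s = <ₗ-++ˡ⁺ s 0<1

≤ₗ-raise : ∀ P s {R R′ t t′} → length P ≡ suc (length s) →
           (P ++ R) ≤ₗ ((s ∷ʳ false) ++ t) → (P ++ R′) <ₗ ((s ∷ʳ true) ++ t′)
≤ₗ-raise P s {R} {R′} {t} {t′} l h with ≤ₗ-++⁻ P (s ∷ʳ false) (trans l (sym (length-∷ʳ s false))) h
... | inj₁ P<s0     = <ₗ-++⁺ R′ t′ (trans l (sym (length-∷ʳ s true))) (<ₗ-trans P<s0 (∷ʳfalse<ₗ∷ʳtrue s))
... | inj₂ (refl , _) = <ₗ-++⁺ {s ∷ʳ false} R′ t′ (trans (length-∷ʳ s false) (sym (length-∷ʳ s true))) (∷ʳfalse<ₗ∷ʳtrue s)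

splitAt-length : ∀ {k} (v : Str) → k ≤ length v → ∃[ P ] ∃[ R ] (v ≡ P ++ R × length P ≡ k)
splitAt-length {k} v k≤ = take k v , drop k v , sym (take++drop≡id k v) , trans (length-take k v) (m≤n⇒m⊓n≡m k≤)

-- Raising the last zero

ones≡++∷⇒true : ∀ k s c t → ones k ≡ s ++ c ∷ t → c ≡ true
ones≡++∷⇒true (suc k) []      c t e = sym (proj₁ (∷-injective e))
ones≡++∷⇒true (suc k) (_ ∷ s) c t e = ones≡++∷⇒true k s c t (∷-injectiveʳ e)

reverse-++ones : ∀ v m → reverse (v ++ ones m) ≡ ones m ++ reverse v
reverse-++ones v m = trans (reverse-++ v (ones m)) (cong (_++ reverse v) (reverse-replicate m true))

-- Raising the last 0 of 0v′01ᵐ to 1: a rotation starting inside v is compared with the corresponding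
-- rotation of the old string, which now carries a 1 where it used to carry a 0.
flipLastZero-RotationMinimal : ∀ m v′ → RotationMinimal ((false ∷ v′) ++ false ∷ ones m) →
                               RotationMinimal ((false ∷ v′) ++ true ∷ ones m)
flipLastZero-RotationMinimal m v′ min x y e with ++-≡-++ x y (false ∷ v′) (ones (suc m)) e
... | inj₁ (s , refl , q) = inOnes y q
  where
  inOnes : ∀ y → ones (suc m) ≡ s ++ y → ((false ∷ v′) ++ ones (suc m)) ≤ₗ (y ++ (false ∷ v′) ++ s)
  inOnes []       q = inj₂ (cong ((false ∷ v′) ++_) (trans q (++-identityʳ s)))
  inOnes (c ∷ y′) q with ones≡++∷⇒true (suc m) s c y′ q
  ... | refl = inj₁ 0<1
... | inj₂ (s , p , q) = inV x p
  where
  inV : ∀ x → false ∷ v′ ≡ x ++ s → ((false ∷ v′) ++ ones (suc m)) ≤ₗ (y ++ x)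
  inV []       p = inj₂ (sym (trans (++-identityʳ y) (trans q (cong (_++ ones (suc m)) (sym p)))))
  inV (c ∷ x′) p with splitAt-length (false ∷ v′) |s|<|v|
    where
    |s|<|v| : suc (length s) ≤ length (false ∷ v′)
    |s|<|v| = subst (suc (length s) ≤_) (cong length (sym p))
                (s≤s (subst (length s ≤_) (sym (length-++ x′)) (m≤n+m (length s) (length x′))))
  ... | P , R , v≡PR , |P| = inj₁ (subst₂ _<ₗ_ γ≡ rot≡ (≤ₗ-raise P s |P| (subst₂ _≤ₗ_ α≡ rotα≡ (min (c ∷ x′) (s ++ false ∷ ones m) αsplit))))
    where
    αsplit : (c ∷ x′) ++ s ++ false ∷ ones m ≡ (false ∷ v′) ++ false ∷ ones m
    αsplit = trans (sym (++-assoc (c ∷ x′) s _)) (cong (_++ false ∷ ones m) (sym p))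
    α≡ : (false ∷ v′) ++ false ∷ ones m ≡ P ++ R ++ false ∷ ones m
    α≡ = trans (cong (_++ false ∷ ones m) v≡PR) (++-assoc P R _)
    rotα≡ : (s ++ false ∷ ones m) ++ c ∷ x′ ≡ (s ∷ʳ false) ++ ones m ++ c ∷ x′
    rotα≡ = trans (++-assoc s _ (c ∷ x′)) (sym (∷ʳ-++ s false (ones m ++ c ∷ x′)))
    γ≡ : P ++ R ++ ones (suc m) ≡ (false ∷ v′) ++ ones (suc m)
    γ≡ = trans (sym (++-assoc P R _)) (cong (_++ ones (suc m)) (sym v≡PR))
    rot≡ : (s ∷ʳ true) ++ ones m ++ c ∷ x′ ≡ y ++ c ∷ x′
    rot≡ = trans (∷ʳ-++ s true (ones m ++ c ∷ x′)) (trans (sym (++-assoc s (ones (suc m)) (c ∷ x′))) (cong (_++ c ∷ x′) (sym q)))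

-- For the reversed rotations, ones-raise-<ₗ does the comparison after the common prefix; its
-- exceptional tails 1ᵃ (a < m) are exactly the decompositions 0v′ = P 1ᵃ with P a palindrome.
module _ (m : ℕ) (v′ : Str) (notPalindrome++ones : ∀ {a} P → a < m → false ∷ v′ ≡ P ++ ones a → reverse P ≢ P)
         (below : StrictlyBelowReversal ((false ∷ v′) ++ false ∷ ones m)) where

  private
    v : Str
    v = false ∷ v′

    γ≡ : ∀ P R → v ≡ P ++ R → P ++ R ++ ones (suc m) ≡ v ++ ones (suc m)
    γ≡ P R v≡PR = trans (sym (++-assoc P R _)) (cong (_++ ones (suc m)) (sym v≡PR))

    main : ∀ w z → reverse v ≡ w ++ z → (v ++ ones (suc m)) <ₗ (z ++ ones (suc m) ++ w)
    main w z vᴿ≡ with splitAt-length v |z|≤|v|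
      where
      |z|≤|v| : length z ≤ length v
      |z|≤|v| = subst (length z ≤_) (trans (sym (length-++ w)) (trans (cong length (sym vᴿ≡)) (length-reverse v)))
                  (m≤n+m (length z) (length w))
    ... | P , R , v≡PR , |P| with <ₗ-++⁻ P z |P| α<rot
      where
      αᴿ≡ : reverse (v ++ false ∷ ones m) ≡ (ones m ++ false ∷ w) ++ z
      αᴿ≡ = trans (reverse-++-∷ v false (ones m))
                  (trans (cong₂ (λ a b → a ++ false ∷ b) (reverse-replicate m true) vᴿ≡) (sym (++-assoc (ones m) (false ∷ w) z)))
      α<rot : (P ++ R ++ false ∷ ones m) <ₗ (z ++ ones m ++ false ∷ w)
      α<rot = subst₂ _<ₗ_ (trans (cong (_++ false ∷ ones m) v≡PR) (++-assoc P R _)) refl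
                (below (ones m ++ false ∷ w) z (sym αᴿ≡))
    ... | inj₁ P<z = subst (_<ₗ (z ++ ones (suc m) ++ w)) (γ≡ P R v≡PR) (<ₗ-++⁺ (R ++ ones (suc m)) (ones (suc m) ++ w) |P| P<z)
    ... | inj₂ (refl , tail<) = subst (_<ₗ (P ++ ones (suc m) ++ w)) (γ≡ P R v≡PR) (<ₗ-++ˡ⁺ P (ones-raise-<ₗ m R w |R|≡|w| notOnes tail<))
      where
      |R|≡|w| : length R ≡ length w
      |R|≡|w| = +-cancelˡ-≡ (length P) (length R) (length w) (begin
        length P + length R ≡⟨ sym (length-++ P) ⟩
        length (P ++ R)     ≡⟨ cong length (sym v≡PR) ⟩
        length v            ≡⟨ sym (length-reverse v) ⟩
        length (reverse v)  ≡⟨ cong length vᴿ≡ ⟩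
        length (w ++ P)     ≡⟨ length-++ w ⟩
        length w + length P ≡⟨ +-comm (length w) (length P) ⟩
        length P + length w ∎)
        where open ≡-Reasoning
      notOnes : ∀ {a} → a < m → R ≢ ones a
      notOnes {a} a<m refl = notPalindrome++ones P a<m v≡PR (proj₂ (++-≡-++-sameLength (ones a) w |R|≡|w| aPᴿ≡wP))
        where
        aPᴿ≡wP : ones a ++ reverse P ≡ w ++ P
        aPᴿ≡wP = trans (sym (reverse-++ones P a)) (trans (cong reverse (sym v≡PR)) vᴿ≡)

  flipLastZero-StrictlyBelowReversal : StrictlyBelowReversal ((false ∷ v′) ++ true ∷ ones m)
  flipLastZero-StrictlyBelowReversal x y e with ++-≡-++ x y (ones (suc m)) (reverse v) (trans e (reverse-++ones v (suc m)))
  ... | inj₁ (s , refl , q) = afterOnes y q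
    where
    afterOnes : ∀ y → reverse v ≡ s ++ y → (v ++ ones (suc m)) <ₗ (y ++ ones (suc m) ++ s)
    afterOnes []      _ = 0<1
    afterOnes (c ∷ y) q = main s (c ∷ y) q
  ... | inj₂ (s , p , q) = inOnes s p q
    where
    inOnes : ∀ s → ones (suc m) ≡ x ++ s → y ≡ s ++ reverse v → (v ++ ones (suc m)) <ₗ (y ++ x)
    inOnes []       p q = subst ((v ++ ones (suc m)) <ₗ_) (cong₂ _++_ (sym q) (trans (++-identityʳ _) (trans p (++-identityʳ x))))
                            (main [] (reverse v) refl)
    inOnes (c ∷ s′) p q with ones≡++∷⇒true (suc m) x c s′ p
    ... | refl = subst ((v ++ ones (suc m)) <ₗ_) (cong (_++ x) (sym q)) 0<1

length-++-∷ : ∀ (xs : Str) b c ys → length (xs ++ b ∷ ys) ≡ length (xs ++ c ∷ ys)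
length-++-∷ []       b c ys = refl
length-++-∷ (_ ∷ xs) b c ys = cong suc (length-++-∷ xs b c ys)

lastOne-lastZero-InA : ∀ {n} j v₁ t →
  length (zeros (suc j) ++ true ∷ v₁ ++ false ∷ ones (suc t)) ≡ n →
  NoZeroRun (suc (suc j)) (zeros (suc j) ++ true ∷ v₁ ++ false ∷ ones (suc t)) →
  StrictlyBelowReversal (zeros (suc j) ++ true ∷ v₁ ++ false ∷ ones (suc t)) →
  (∀ {a} → a < suc t → true ∷ v₁ ≢ ones a) →
  InA n (lastOne (lastZero (zeros (suc j) ++ true ∷ v₁ ++ false ∷ ones (suc t))))
lastOne-lastZero-InA {n} j v₁ t l noRun below notOnes =
  subst (InA n ∘ lastOne) (sym lastZero≡) (lastOne-InA l′ refl noRun-w (v₁ ++ ones (suc t) , refl) ends-w w<wᴿ)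
  where
  J = suc j
  u = true ∷ v₁
  w = u ++ ones (suc t)
  α≡ : zeros J ++ u ++ false ∷ ones (suc t) ≡ (zeros J ++ u) ++ false ∷ ones (suc t)
  α≡ = sym (++-assoc (zeros J) u _)
  lastZero≡ : lastZero (zeros J ++ u ++ false ∷ ones (suc t)) ≡ (zeros J ++ w) ∷ʳ true
  lastZero≡ = begin
    lastZero (zeros J ++ u ++ false ∷ ones (suc t))   ≡⟨ cong lastZero α≡ ⟩
    lastZero ((zeros J ++ u) ++ false ∷ ones (suc t)) ≡⟨ lastZero-++ones (zeros J ++ u) (suc t) ⟩
    (zeros J ++ u) ++ ones (suc (suc t))               ≡⟨ cong ((zeros J ++ u) ++_) (sym (replicate-∷ʳ (suc t) true)) ⟩
    (zeros J ++ u) ++ ones (suc t) ∷ʳ true             ≡⟨ sym (++-assoc (zeros J ++ u) (ones (suc t)) (true ∷ [])) ⟩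
    ((zeros J ++ u) ++ ones (suc t)) ∷ʳ true           ≡⟨ cong (_∷ʳ true) (++-assoc (zeros J) u (ones (suc t))) ⟩
    (zeros J ++ w) ∷ʳ true                             ∎
    where open ≡-Reasoning
  l′ : length ((zeros J ++ w) ∷ʳ true) ≡ n
  l′ = trans (cong length (sym lastZero≡)) (trans (cong (length ∘ lastZero) α≡)
             (trans (cong length (lastZero-++ones (zeros J ++ u) (suc t)))
                    (trans (length-++-∷ (zeros J ++ u) true false (ones (suc t))) (trans (cong length (sym α≡)) l))))
  noRun-w : NoZeroRun (suc J) w
  noRun-w = NoZeroRun-true∷ (v₁ ++ ones (suc t)) (NoZeroRun-++ones (suc t) v₁
              (NoZeroRun-infix (zeros J ∷ʳ true) v₁ (false ∷ ones (suc t))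
                (subst (NoZeroRun (suc J)) (sym (∷ʳ-++ (zeros J) true (v₁ ++ false ∷ ones (suc t)))) noRun)))
  ends-w : Ends1 w
  ends-w = u ++ ones t , trans (cong (u ++_) (sym (replicate-∷ʳ t true))) (sym (++-assoc u (ones t) (true ∷ [])))
  u01<10uᴿ : (u ++ false ∷ ones (suc t)) <ₗ (ones (suc t) ++ false ∷ reverse u)
  u01<10uᴿ = <ₗ-++ˡ⁻ (zeros J) (below (ones (suc t) ++ false ∷ reverse u) (zeros J) αᴿ≡)
    where
    αᴿ≡ : (ones (suc t) ++ false ∷ reverse u) ++ zeros J ≡ reverse (zeros J ++ u ++ false ∷ ones (suc t))
    αᴿ≡ = sym (trans (reverse-++ (zeros J) (u ++ false ∷ ones (suc t)))
                (cong₂ _++_ (trans (reverse-++-∷ u false (ones (suc t))) (cong (_++ false ∷ reverse u) (reverse-replicate (suc t) true)))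
                            (reverse-replicate J false)))
  w<wᴿ : w <ₗ reverse w
  w<wᴿ = subst (w <ₗ_) (sym (reverse-++ones u (suc t))) (ones-shift-<ₗ (suc t) u notOnes u01<10uᴿ)

StrictlyBelowReversal⇒≢rotation-of-reverse : ∀ {α} → StrictlyBelowReversal α → ∀ x y → x ++ y ≡ reverse α → y ++ x ≢ α
StrictlyBelowReversal⇒≢rotation-of-reverse {α} below x y e q = <ₗ-irrefl (subst (α <ₗ_) q (below x y e))

StrictlyBelowReversal⇒¬palindrome : ∀ {α} → StrictlyBelowReversal α → reverse α ≢ α
StrictlyBelowReversal⇒¬palindrome {α} below e =
  StrictlyBelowReversal⇒≢rotation-of-reverse below [] (reverse α) refl (trans (++-identityʳ _) e)

StrictlyBelowReversal⇒≢replicate : ∀ {α} → StrictlyBelowReversal α → ∀ k c → α ≢ replicate k c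
StrictlyBelowReversal⇒≢replicate below k c e =
  StrictlyBelowReversal⇒¬palindrome below (trans (cong reverse e) (trans (reverse-replicate k c) (sym e)))

ones⊎false : ∀ s → s ≡ ones (length s) ⊎ ∃[ a ] ∃[ b ] s ≡ a ++ false ∷ b
ones⊎false []          = inj₁ refl
ones⊎false (false ∷ s) = inj₂ ([] , s , refl)
ones⊎false (true ∷ s) with ones⊎false s
... | inj₁ e           = inj₁ (cong (true ∷_) e)
... | inj₂ (a , b , e) = inj₂ (true ∷ a , b , cong (true ∷_) e)

asymmetricBracelet-head : ∀ {α} → RotationMinimal α → StrictlyBelowReversal α → ∃[ j ] ∃[ ρ ] α ≡ zeros (suc j) ++ true ∷ ρ
asymmetricBracelet-head {α} min below with zeros-split α
... | inj₁ (b , e)           = ⊥-elim (StrictlyBelowReversal⇒≢replicate below b false e)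
... | inj₂ (suc j , ρ , e)   = j , ρ , e
... | inj₂ (zero , ρ , e) with ones⊎false ρ
...   | inj₁ e′ = ⊥-elim (StrictlyBelowReversal⇒≢replicate below (suc (length ρ)) true (trans e (cong (true ∷_) e′)))
...   | inj₂ (a , b , e′) = ⊥-elim (≤ₗ⇒≯ₗ (subst (_≤ₗ (false ∷ b ++ true ∷ a)) α≡ (min (true ∷ a) (false ∷ b) (sym α≡))) 0<1)
  where
  α≡ : α ≡ true ∷ a ++ false ∷ b
  α≡ = trans e (cong (true ∷_) e′)

asymmetricBracelet-last : ∀ {α} → 0 < length α → RotationMinimal α → StrictlyBelowReversal α → Ends1 α
asymmetricBracelet-last {α} pos min below with initLast α
... | []           = ⊥-elim (<-irrefl refl pos)
... | s ∷ʳ′ true  = s , refl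
... | s ∷ʳ′ false = ⊥-elim (StrictlyBelowReversal⇒≢replicate below (suc (length s)) false α≡zeros)
  where
  α≡zeros : s ∷ʳ false ≡ zeros (suc (length s))
  α≡zeros = trans (cong (_∷ʳ false) (∷ʳfalse≤ₗfalse∷⇒zeros s (min s (false ∷ []) refl))) (replicate-∷ʳ (length s) false)

RotationMinimal⇒NoZeroRun : ∀ {J ρ} → RotationMinimal (zeros J ++ true ∷ ρ) → NoZeroRun (suc J) (zeros J ++ true ∷ ρ)
RotationMinimal⇒NoZeroRun {J} {ρ} min u v e =
  ≤ₗ⇒≯ₗ (min u (zeros (suc J) ++ v) (sym e))
    (subst (_<ₗ (zeros J ++ true ∷ ρ)) (sym (++-assoc (zeros (suc J)) v u)) (zeros<ₗzeros++true (v ++ u) ρ (n<1+n J)))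

11≤ₗ⇒11 : ∀ {X} Y → (true ∷ true ∷ X) ≤ₗ Y → ∃[ Y′ ] Y ≡ true ∷ true ∷ Y′
11≤ₗ⇒11 (true ∷ true ∷ Y′) _ = Y′ , refl
11≤ₗ⇒11 []                 (inj₁ ())
11≤ₗ⇒11 []                 (inj₂ ())
11≤ₗ⇒11 (false ∷ _)        (inj₁ ())
11≤ₗ⇒11 (false ∷ _)        (inj₂ ())
11≤ₗ⇒11 (true ∷ [])        (inj₁ (∷<∷ ()))
11≤ₗ⇒11 (true ∷ [])        (inj₂ ())
11≤ₗ⇒11 (true ∷ false ∷ _) (inj₁ (∷<∷ ()))
11≤ₗ⇒11 (true ∷ false ∷ _) (inj₂ ())

-- The string is α = P 1011 where P = x 0 1 0ᴶ = 0ᴶ 1 s (J = j + 1), and the last hypothesis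
-- says δᴿ ≤ δ for δ = 11δ₂. If J = 1, the rotation 0101011x lies below α. If J ≥ 2,
-- the rotation 0ᴶ1011x01 gives δ₂ ≤ x01, so 01x ≤ x01; but x01 < 01x because x01 begins with 00.
palindrome-01011-¬RotationMinimal : ∀ j x δ₂ s →
  RotationMinimal (zeros (suc j) ++ true ∷ false ∷ true ∷ true ∷ δ₂) →
  zeros (suc j) ++ true ∷ false ∷ true ∷ true ∷ δ₂ ≡ x ++ false ∷ true ∷ zeros (suc j) ++ true ∷ false ∷ true ∷ true ∷ [] →
  x ++ false ∷ true ∷ zeros (suc j) ≡ zeros (suc j) ++ true ∷ s →
  (true ∷ true ∷ false ∷ true ∷ x) ≤ₗ (true ∷ true ∷ δ₂) → ⊥
palindrome-01011-¬RotationMinimal zero x δ₂ s min e _ _ =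
  ≤ₗ⇒≯ₗ (min x (false ∷ true ∷ false ∷ true ∷ false ∷ true ∷ true ∷ []) (sym e)) (∷<∷ (∷<∷ (∷<∷ (∷<∷ 0<1))))
palindrome-01011-¬RotationMinimal (suc j) x δ₂ s min e x01≡ hδ = ≤ₗ⇒≯ₗ 01x≤x01 (x01<01x x x01≡)
  where
  J = suc (suc j)
  ₁₀₁₁ : Str
  ₁₀₁₁ = true ∷ false ∷ true ∷ true ∷ []
  split≡ : (x ++ false ∷ true ∷ []) ++ zeros J ++ ₁₀₁₁ ≡ zeros J ++ true ∷ false ∷ true ∷ true ∷ δ₂
  split≡ = trans (++-assoc x (false ∷ true ∷ []) _) (sym e)
  δ₂≤ : (true ∷ true ∷ δ₂) ≤ₗ (true ∷ true ∷ x ++ false ∷ true ∷ [])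
  δ₂≤ = ≤ₗ-++ˡ⁻ (true ∷ false ∷ []) (≤ₗ-++ˡ⁻ (zeros J)
          (subst ((zeros J ++ true ∷ false ∷ true ∷ true ∷ δ₂) ≤ₗ_) (++-assoc (zeros J) ₁₀₁₁ (x ++ false ∷ true ∷ [])) (min (x ++ false ∷ true ∷ []) (zeros J ++ ₁₀₁₁) split≡)))
  01x≤x01 : (false ∷ true ∷ x) ≤ₗ (x ++ false ∷ true ∷ [])
  01x≤x01 = ≤ₗ-++ˡ⁻ (true ∷ true ∷ []) (≤ₗ-trans hδ δ₂≤)
  x01<01x : ∀ x → x ++ false ∷ true ∷ zeros J ≡ zeros J ++ true ∷ s → (x ++ false ∷ true ∷ []) <ₗ (false ∷ true ∷ x)
  x01<01x []                  ()
  x01<01x (true ∷ _)          ()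
  x01<01x (false ∷ true ∷ _)  ()
  x01<01x (false ∷ [])        _ = ∷<∷ 0<1
  x01<01x (false ∷ false ∷ _) _ = ∷<∷ 0<1

zeros++ones-¬StrictlyBelowReversal : ∀ a b → ¬ StrictlyBelowReversal (zeros a ++ ones b)
zeros++ones-¬StrictlyBelowReversal a b below =
  StrictlyBelowReversal⇒≢rotation-of-reverse below (ones b) (zeros a) (sym reverse≡) refl
  where
  reverse≡ : reverse (zeros a ++ ones b) ≡ ones b ++ zeros a
  reverse≡ = trans (reverse-++ (zeros a) (ones b)) (cong₂ _++_ (reverse-replicate b true) (reverse-replicate a false))

ones⊎lastZero : ∀ s → s ≡ ones (length s) ⊎ ∃[ β ] ∃[ t ] s ≡ β ++ false ∷ ones t
ones⊎lastZero []      = inj₁ refl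
ones⊎lastZero (c ∷ s) with ones⊎lastZero s
... | inj₂ (β , t , e) = inj₂ (c ∷ β , t , cong (c ∷_) e)
ones⊎lastZero (true ∷ s)  | inj₁ e = inj₁ (cong (true ∷_) e)
ones⊎lastZero (false ∷ s) | inj₁ e = inj₂ ([] , length s , cong (false ∷_) e)

zeros++true≡++true⇒ : ∀ k z {a b} → zeros k ++ true ∷ a ≡ z ++ true ∷ b → ∃[ d ] z ≡ zeros k ++ d
zeros++true≡++true⇒ zero    z       _ = z , refl
zeros++true≡++true⇒ (suc k) []      ()
zeros++true≡++true⇒ (suc k) (c ∷ z) e with ∷-injective e
... | refl , e′ = proj₁ (zeros++true≡++true⇒ k z e′) , cong (false ∷_) (proj₂ (zeros++true≡++true⇒ k z e′))

module _ {n α} (0<n : 0 < n) (α∈A : InA n α) where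

  private
    |α|≡n : length α ≡ n
    |α|≡n = proj₁ α∈A

    0<|α| : 0 < length α
    0<|α| = subst (0 <_) (sym |α|≡n) 0<n

    min : RotationMinimal α
    min = InA⇒RotationMinimal α∈A

    below : StrictlyBelowReversal α
    below = InA⇒StrictlyBelowReversal 0<|α| α∈A

    α-ends1 : Ends1 α
    α-ends1 = asymmetricBracelet-last 0<|α| min below

    ¬α≡∷ʳfalse : ∀ s → α ≢ s ∷ʳ false
    ¬α≡∷ʳfalse s e with α-ends1
    ... | s′ , e′ with ∷ʳ-injectiveʳ s s′ (trans (sym e) e′)
    ...   | ()

    noZeroRun : ∀ {J ρ} → α ≡ zeros J ++ true ∷ ρ → NoZeroRun (suc J) α
    noZeroRun {J} α≡ = subst (NoZeroRun (suc J)) (sym α≡) (RotationMinimal⇒NoZeroRun (subst RotationMinimal α≡ min))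

  module _ (firstOne∉A : ¬ InA n (firstOne α)) where

    firstOne∉A⇒reverse≤ₗ : ∀ {J k δ₁} → α ≡ zeros J ++ true ∷ zeros k ++ true ∷ δ₁ → reverse (true ∷ δ₁) ≤ₗ (true ∷ δ₁)
    firstOne∉A⇒reverse≤ₗ {J} {k} {δ₁} α≡ with <ₗ-or-≥ₗ (true ∷ δ₁) (reverse (true ∷ δ₁))
    ... | inj₂ δᴿ≤δ = δᴿ≤δ
    ... | inj₁ δ<δᴿ = ⊥-elim (firstOne∉A (subst (InA n) (sym firstOne≡) (zeros++-InA |η| noRun-δ (δ₁ , refl) ends-δ δ<δᴿ)))
      where
      δ = true ∷ δ₁
      firstOne≡ : firstOne α ≡ zeros (suc (J + k)) ++ δ
      firstOne≡ = trans (cong firstOne α≡) (trans (firstOne-zeros J (zeros k ++ δ))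
                    (cong (false ∷_) (trans (sym (++-assoc (zeros J) (zeros k) δ)) (cong (_++ δ) (replicate-+ J k false)))))
      |η| : length (zeros (suc (J + k)) ++ δ) ≡ n
      |η| = trans (cong length (sym firstOne≡)) (trans (length-firstOne α) |α|≡n)
      α≡′ : α ≡ (zeros J ++ true ∷ zeros k) ++ δ
      α≡′ = trans α≡ (sym (++-assoc (zeros J) (true ∷ zeros k) δ))
      noRun-δ : NoZeroRun (suc (J + k)) δ
      noRun-δ = NoZeroRun-mono δ (s≤s (m≤m+n J k))
                  (NoZeroRun-++⁻ʳ (zeros J ++ true ∷ zeros k) δ (subst (NoZeroRun (suc J)) α≡′ (noZeroRun α≡)))
      ends-δ : Ends1 δ
      ends-δ = Ends1-++⁻ʳ (zeros J ++ true ∷ zeros k) true δ₁ (subst Ends1 α≡′ α-ends1)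

    shape : ∃[ j ] ∃[ k ] ∃[ δ₁ ] α ≡ zeros (suc j) ++ true ∷ zeros (suc k) ++ true ∷ δ₁
    shape with asymmetricBracelet-head min below
    ... | j , ρ , α≡ with zeros-split ρ
    ...   | inj₂ (suc k , δ₁ , ρ≡) = j , k , δ₁ , trans α≡ (cong (λ t → zeros (suc j) ++ true ∷ t) ρ≡)
    ...   | inj₁ (zero , ρ≡) = ⊥-elim
      (zeros++ones-¬StrictlyBelowReversal (suc j) 1 (subst StrictlyBelowReversal (trans α≡ (cong (λ t → zeros (suc j) ++ true ∷ t) ρ≡)) below))
    ...   | inj₁ (suc k , ρ≡) = ⊥-elim (¬α≡∷ʳfalse (zeros (suc j) ++ true ∷ zeros k) (begin
      α                                       ≡⟨ α≡ ⟩
      zeros (suc j) ++ true ∷ ρ               ≡⟨ cong (λ t → zeros (suc j) ++ true ∷ t) (trans ρ≡ (sym (replicate-∷ʳ k false))) ⟩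
      zeros (suc j) ++ true ∷ zeros k ∷ʳ false ≡⟨ sym (++-assoc (zeros (suc j)) (true ∷ zeros k) (false ∷ [])) ⟩
      (zeros (suc j) ++ true ∷ zeros k) ∷ʳ false ∎))
      where open ≡-Reasoning
    ...   | inj₂ (zero , δ₁ , ρ≡) = ⊥-elim (zeros++ones-¬StrictlyBelowReversal J (suc (length δ))
                                      (subst StrictlyBelowReversal (trans α≡′ (cong (λ t → zeros J ++ true ∷ t) δ≡ones)) below))
      where
      J = suc j
      δ = true ∷ δ₁
      α≡′ : α ≡ zeros J ++ true ∷ δ
      α≡′ = trans α≡ (cong (λ t → zeros J ++ true ∷ t) ρ≡)
      -- 1δ < δᴿ1 from the reversed rotation 0ᴶ δᴿ 1, and δᴿ ≤ δ because FirstOne(α) ∉ A(n).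
      1δ<δᴿ1 : (true ∷ δ) <ₗ (reverse δ ∷ʳ true)
      1δ<δᴿ1 = <ₗ-++ˡ⁻ (zeros J) (subst (_<ₗ (zeros J ++ reverse δ ∷ʳ true)) α≡′ (below (reverse δ ∷ʳ true) (zeros J) αᴿ≡))
        where
        αᴿ≡ : (reverse δ ∷ʳ true) ++ zeros J ≡ reverse α
        αᴿ≡ = sym (trans (cong reverse α≡′) (trans (reverse-++-∷ (zeros J) true δ)
                (trans (cong (λ t → reverse δ ++ true ∷ t) (reverse-replicate J false)) (sym (∷ʳ-++ (reverse δ) true (zeros J))))))
      δ≡ones : δ ≡ ones (length δ)
      δ≡ones = true∷≤ₗ∷ʳtrue⇒ones δ
                 (inj₁ (<ₗ-≤ₗ-trans 1δ<δᴿ1 (≤ₗ-++ʳ⁺ (true ∷ []) (length-reverse δ) (firstOne∉A⇒reverse≤ₗ {J} {0} α≡′))))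

    module _ (α≢r : α ≢ r n) (lastOne∉A : ¬ InA n (lastOne α))
             {j k δ₁} (α≡ : α ≡ zeros (suc j) ++ true ∷ zeros (suc k) ++ true ∷ δ₁) where

      private
        J : ℕ
        J = suc j

        noRun : NoZeroRun (suc J) α
        noRun = noZeroRun α≡

        α≡1011⇒α≡r : α ≡ zeros J ++ true ∷ false ∷ true ∷ true ∷ [] → α ≡ r n
        α≡1011⇒α≡r e = trans e (cong (λ m → zeros m ++ true ∷ false ∷ true ∷ true ∷ []) (sym n∸4≡J))
          where
          n∸4≡J : n ∸ 4 ≡ J
          n∸4≡J = trans (cong (_∸ 4) (trans (sym |α|≡n) (trans (cong length e)
                    (trans (length-++ (zeros J)) (cong (_+ 4) (length-replicate J)))))) (m+n∸n≡m J 4)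

      lastOne∉A⇒reverse≤ₗ : ∀ w₁ → α ≡ (zeros J ++ true ∷ w₁) ∷ʳ true → Ends1 (true ∷ w₁) →
                            reverse (true ∷ w₁) ≤ₗ (true ∷ w₁)
      lastOne∉A⇒reverse≤ₗ w₁ α≡′ ends-w with <ₗ-or-≥ₗ (true ∷ w₁) (reverse (true ∷ w₁))
      ... | inj₂ wᴿ≤w = wᴿ≤w
      ... | inj₁ w<wᴿ = ⊥-elim (lastOne∉A (subst (InA n ∘ lastOne) (sym α≡′)
                          (lastOne-InA (trans (cong length (sym α≡′)) |α|≡n) refl noRun-w (w₁ , refl) ends-w w<wᴿ)))
        where
        noRun-w : NoZeroRun (suc J) (true ∷ w₁)
        noRun-w = NoZeroRun-infix (zeros J) (true ∷ w₁) (true ∷ [])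
                    (subst (NoZeroRun (suc J)) (trans α≡′ (++-assoc (zeros J) (true ∷ w₁) (true ∷ []))) noRun)

      lastZero-split : ∃[ v₁ ] ∃[ t ] ((v₁ ≡ [] ⊎ ∃[ v₂ ] v₁ ≡ false ∷ v₂) × α ≡ zeros J ++ true ∷ v₁ ++ false ∷ ones t)
      lastZero-split with ones⊎lastZero (true ∷ δ₁)
      ... | inj₁ δ≡ = zeros k , length (true ∷ δ₁) , zeros-head k ,
                      trans α≡ (trans (cong (λ s → zeros J ++ true ∷ false ∷ zeros k ++ s) δ≡)
                                      (cong (λ s → zeros J ++ true ∷ s) (sym (replicate-++-∷ k false (ones (length (true ∷ δ₁)))))))
        where
        zeros-head : ∀ k → zeros k ≡ [] ⊎ ∃[ v₂ ] zeros k ≡ false ∷ v₂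
        zeros-head zero    = inj₁ refl
        zeros-head (suc k) = inj₂ (zeros k , refl)
      ... | inj₂ (β , t , δ≡) = false ∷ zeros k ++ β , t , inj₂ (zeros k ++ β , refl) ,
                                trans α≡ (cong (λ s → zeros J ++ true ∷ false ∷ s) (trans (cong (zeros k ++_) δ≡) (sym (++-assoc (zeros k) β _))))

      ending : ∃[ v₁ ] ∃[ t ] ((t ≡ 1 ⊎ t ≡ 2) × α ≡ zeros J ++ true ∷ v₁ ++ false ∷ ones t)
      ending with lastZero-split
      ... | v₁ , 0 , _ , α≡v = ⊥-elim (¬α≡∷ʳfalse (zeros J ++ true ∷ v₁) (trans α≡v (sym (++-assoc (zeros J) (true ∷ v₁) (false ∷ [])))))
      ... | v₁ , 1 , _ , α≡v = v₁ , 1 , inj₁ refl , α≡v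
      ... | v₁ , 2 , _ , α≡v = v₁ , 2 , inj₂ refl , α≡v
      ... | v₁ , suc (suc (suc t)) , v₁-head , α≡v = ⊥-elim (≤ₗ⇒≯ₗ (lastOne∉A⇒reverse≤ₗ w₁ α≡′ ends-w) w<wᴿ)
        where
        w₁ : Str
        w₁ = v₁ ++ false ∷ ones (suc (suc t))
        α≡′ : α ≡ (zeros J ++ true ∷ w₁) ∷ʳ true
        α≡′ = trans α≡v (trans (cong (λ s → zeros J ++ true ∷ v₁ ++ false ∷ s) (sym (replicate-∷ʳ (suc (suc t)) true)))
                (trans (cong (λ s → zeros J ++ true ∷ s) (sym (++-assoc v₁ (false ∷ ones (suc (suc t))) (true ∷ []))))
                       (sym (++-assoc (zeros J) (true ∷ w₁) (true ∷ [])))))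
        ends-w : Ends1 (true ∷ w₁)
        ends-w = true ∷ v₁ ++ false ∷ ones (suc t) ,
                 cong (true ∷_) (trans (cong (λ s → v₁ ++ false ∷ s) (sym (replicate-∷ʳ (suc t) true)))
                                       (sym (++-assoc v₁ (false ∷ ones (suc t)) (true ∷ []))))
        10<11 : ∀ v₁ {X} → (v₁ ≡ [] ⊎ ∃[ v₂ ] v₁ ≡ false ∷ v₂) → (true ∷ v₁ ++ false ∷ ones (suc (suc t))) <ₗ (true ∷ true ∷ X)
        10<11 _ (inj₁ refl)       = ∷<∷ 0<1
        10<11 _ (inj₂ (_ , refl)) = ∷<∷ 0<1
        w<wᴿ : (true ∷ w₁) <ₗ reverse (true ∷ w₁)
        w<wᴿ = subst ((true ∷ w₁) <ₗ_)
                 (sym (trans (reverse-++-∷ (true ∷ v₁) false (ones (suc (suc t))))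
                             (cong (_++ false ∷ reverse (true ∷ v₁)) (reverse-replicate (suc (suc t)) true))))
                 (10<11 v₁ v₁-head)

      prefix-not-palindrome : ∀ v₁ X → α ≡ zeros J ++ true ∷ v₁ ++ false ∷ X → reverse (zeros J ++ true ∷ v₁) ≢ zeros J ++ true ∷ v₁
      prefix-not-palindrome v₁ X α≡v vᴿ≡v = noRun (reverse v₁ ∷ʳ true) X (begin
        α                                                      ≡⟨ α≡v ⟩
        zeros J ++ true ∷ v₁ ++ false ∷ X                      ≡⟨ sym (++-assoc (zeros J) (true ∷ v₁) (false ∷ X)) ⟩
        (zeros J ++ true ∷ v₁) ++ false ∷ X                    ≡⟨ cong (_++ false ∷ X) (sym vᴿ≡v) ⟩
        reverse (zeros J ++ true ∷ v₁) ++ false ∷ X            ≡⟨ cong (_++ false ∷ X) (reverse-++-∷ (zeros J) true v₁) ⟩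
        (reverse v₁ ++ true ∷ reverse (zeros J)) ++ false ∷ X  ≡⟨ cong (λ s → (reverse v₁ ++ true ∷ s) ++ false ∷ X) (reverse-replicate J false) ⟩
        (reverse v₁ ++ true ∷ zeros J) ++ false ∷ X            ≡⟨ ++-assoc (reverse v₁) (true ∷ zeros J) (false ∷ X) ⟩
        reverse v₁ ++ true ∷ zeros J ++ false ∷ X              ≡⟨ cong (λ s → reverse v₁ ++ true ∷ s) (replicate-++-∷ J false X) ⟩
        reverse v₁ ++ true ∷ zeros (suc J) ++ X                ≡⟨ sym (∷ʳ-++ (reverse v₁) true (zeros (suc J) ++ X)) ⟩
        (reverse v₁ ∷ʳ true) ++ zeros (suc J) ++ X             ∎)
        where open ≡-Reasoning

      palindrome++1011-impossible : ∀ z → α ≡ zeros J ++ true ∷ z ++ true ∷ false ∷ true ∷ true ∷ [] →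
                                    reverse (zeros J ++ true ∷ z) ≢ zeros J ++ true ∷ z
      palindrome++1011-impossible z α≡z with zeros++true≡++true⇒ (suc k) z (tail≡ z α≡z)
        where
        tail≡ : ∀ z → α ≡ zeros J ++ true ∷ z ++ true ∷ false ∷ true ∷ true ∷ [] →
                zeros (suc k) ++ true ∷ δ₁ ≡ z ++ true ∷ false ∷ true ∷ true ∷ []
        tail≡ z α≡z = ∷-injectiveʳ (++-cancelˡ (zeros J) _ _ (trans (sym α≡) α≡z))
      ... | d , refl = byZeroRun k α≡z
        where
        ₁₀₁₁ : Str
        ₁₀₁₁ = true ∷ false ∷ true ∷ true ∷ []
        δ≡ : true ∷ δ₁ ≡ d ++ ₁₀₁₁
        δ≡ = ++-cancelˡ (zeros (suc k)) _ _
               (trans (∷-injectiveʳ (++-cancelˡ (zeros J) _ _ (trans (sym α≡) α≡z))) (++-assoc (zeros (suc k)) d ₁₀₁₁))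
        hδ : (true ∷ true ∷ false ∷ true ∷ reverse d) ≤ₗ (d ++ ₁₀₁₁)
        hδ = subst₂ _≤ₗ_ (trans (cong reverse δ≡) (reverse-++ d ₁₀₁₁)) δ≡ (firstOne∉A⇒reverse≤ₗ {J} {suc k} α≡)
        byZeroRun : ∀ k′ → α ≡ zeros J ++ true ∷ (zeros (suc k′) ++ d) ++ ₁₀₁₁ →
              reverse (zeros J ++ true ∷ zeros (suc k′) ++ d) ≢ zeros J ++ true ∷ zeros (suc k′) ++ d
        byZeroRun (suc k″) α≡′ _ = ≤ₗ⇒≯ₗ (lastOne∉A⇒reverse≤ₗ w₁ α≡″ ends-w) w<wᴿ
          where
          K = suc (suc k″)
          w₁ = zeros K ++ d ++ true ∷ false ∷ true ∷ []
          w₁1≡ : w₁ ∷ʳ true ≡ zeros K ++ d ++ ₁₀₁₁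
          w₁1≡ = trans (++-assoc (zeros K) _ (true ∷ [])) (cong (zeros K ++_) (++-assoc d _ (true ∷ [])))
          α≡″ : α ≡ (zeros J ++ true ∷ w₁) ∷ʳ true
          α≡″ = trans α≡′ (trans (cong (λ s → zeros J ++ true ∷ s) (trans (++-assoc (zeros K) d ₁₀₁₁) (sym w₁1≡)))
                                 (sym (++-assoc (zeros J) (true ∷ w₁) (true ∷ []))))
          ends-w : Ends1 (true ∷ w₁)
          ends-w = true ∷ zeros K ++ d ++ true ∷ false ∷ [] ,
                   cong (true ∷_) (sym (trans (++-assoc (zeros K) _ (true ∷ [])) (cong (zeros K ++_) (++-assoc d _ (true ∷ [])))))
          w<wᴿ : (true ∷ w₁) <ₗ reverse (true ∷ w₁)
          w<wᴿ = subst ((true ∷ w₁) <ₗ_)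
                   (sym (trans (cong reverse (sym (++-assoc (true ∷ zeros K) d (true ∷ false ∷ true ∷ []))))
                               (reverse-++ ((true ∷ zeros K) ++ d) (true ∷ false ∷ true ∷ []))))
                   (∷<∷ (∷<∷ 0<1))
        byZeroRun zero α≡′ Pᴿ≡P with 11≤ₗ⇒11 (d ++ ₁₀₁₁) hδ
        ... | δ₂ , d1011≡ = palindrome-01011-¬RotationMinimal j (reverse d) δ₂ (false ∷ d)
                              (subst RotationMinimal α≡₂ min) (trans (sym α≡₂) α≡pal) (trans (sym Pᴿ≡) Pᴿ≡P)
                              (subst ((true ∷ true ∷ false ∷ true ∷ reverse d) ≤ₗ_) d1011≡ hδ)
          where
          α≡₂ : α ≡ zeros J ++ true ∷ false ∷ true ∷ true ∷ δ₂
          α≡₂ = trans α≡′ (cong (λ s → zeros J ++ true ∷ false ∷ s) d1011≡)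
          Pᴿ≡ : reverse (zeros J ++ true ∷ false ∷ d) ≡ reverse d ++ false ∷ true ∷ zeros J
          Pᴿ≡ = trans (reverse-++-∷ (zeros J) true (false ∷ d))
                  (trans (cong₂ (λ a b → a ++ true ∷ b) (unfold-reverse false d) (reverse-replicate J false))
                         (∷ʳ-++ (reverse d) false (true ∷ zeros J)))
          α≡pal : α ≡ reverse d ++ false ∷ true ∷ zeros J ++ ₁₀₁₁
          α≡pal = begin
            α                                                ≡⟨ α≡′ ⟩
            zeros J ++ true ∷ false ∷ d ++ ₁₀₁₁              ≡⟨ sym (++-assoc (zeros J) (true ∷ false ∷ d) ₁₀₁₁) ⟩
            (zeros J ++ true ∷ false ∷ d) ++ ₁₀₁₁            ≡⟨ cong (_++ ₁₀₁₁) (sym Pᴿ≡P) ⟩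
            reverse (zeros J ++ true ∷ false ∷ d) ++ ₁₀₁₁    ≡⟨ cong (_++ ₁₀₁₁) Pᴿ≡ ⟩
            (reverse d ++ false ∷ true ∷ zeros J) ++ ₁₀₁₁    ≡⟨ ++-assoc (reverse d) (false ∷ true ∷ zeros J) ₁₀₁₁ ⟩
            reverse d ++ false ∷ true ∷ zeros J ++ ₁₀₁₁      ∎
            where open ≡-Reasoning

      palindrome∷ʳtrue-impossible : ∀ v₁ P → α ≡ zeros J ++ true ∷ v₁ ++ false ∷ ones 2 →
                                    zeros J ++ true ∷ v₁ ≡ P ∷ʳ true → reverse P ≢ P
      palindrome∷ʳtrue-impossible v₁ P α≡v v≡ with initLast v₁
      ... | []      = λ _ → α≢r (α≡1011⇒α≡r α≡v)
      ... | z ∷ʳ′ c with ∷ʳ-injective (zeros J ++ true ∷ z) P (trans (++-assoc (zeros J) (true ∷ z) (c ∷ [])) v≡)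
      ...   | refl , refl =
        palindrome++1011-impossible z (trans α≡v (cong (λ s → zeros J ++ true ∷ s) (++-assoc z (true ∷ []) (false ∷ ones 2))))

      notPalindrome++ones : ∀ v₁ t → (t ≡ 1 ⊎ t ≡ 2) → α ≡ zeros J ++ true ∷ v₁ ++ false ∷ ones t →
                            ∀ {a} P → a < t → zeros J ++ true ∷ v₁ ≡ P ++ ones a → reverse P ≢ P
      notPalindrome++ones v₁ t _ α≡v {zero} P _ v≡P =
        subst (λ Q → reverse Q ≢ Q) (trans v≡P (++-identityʳ P)) (prefix-not-palindrome v₁ (ones t) α≡v)
      notPalindrome++ones v₁ _ (inj₂ refl) α≡v {suc zero}    P _ v≡P = palindrome∷ʳtrue-impossible v₁ P α≡v v≡P
      notPalindrome++ones v₁ _ (inj₁ refl) α≡v {suc a}       P (s≤s ())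
      notPalindrome++ones v₁ _ (inj₂ refl) α≡v {suc (suc a)} P (s≤s (s≤s ()))

      notOnes : ∀ v₁ t → (t ≡ 1 ⊎ t ≡ 2) → α ≡ zeros J ++ true ∷ v₁ ++ false ∷ ones t → ∀ {a} → a < t → true ∷ v₁ ≢ ones a
      notOnes v₁ _ (inj₂ refl) α≡v {suc zero}    _ e =
        α≢r (α≡1011⇒α≡r (trans α≡v (cong (λ s → zeros J ++ true ∷ s ++ false ∷ ones 2) (∷-injectiveʳ e))))
      notOnes v₁ _ (inj₁ refl) α≡v {suc a}       (s≤s ())
      notOnes v₁ _ (inj₂ refl) α≡v {suc (suc a)} (s≤s (s≤s ()))

      lastZero-α-InA : ∀ v₁ t → (t ≡ 1 ⊎ t ≡ 2) → α ≡ zeros J ++ true ∷ v₁ ++ false ∷ ones t → InA n (lastZero α)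
      lastZero-α-InA v₁ t t∈ α≡v = subst (InA n) (sym lastZero≡) (InA-intro |γ| γ-min γ-below)
        where
        v′ = zeros j ++ true ∷ v₁
        α≡′ : α ≡ (false ∷ v′) ++ false ∷ ones t
        α≡′ = trans α≡v (sym (++-assoc (zeros J) (true ∷ v₁) (false ∷ ones t)))
        lastZero≡ : lastZero α ≡ (false ∷ v′) ++ true ∷ ones t
        lastZero≡ = trans (cong lastZero α≡′) (lastZero-++ones (false ∷ v′) t)
        |γ| : length ((false ∷ v′) ++ true ∷ ones t) ≡ n
        |γ| = trans (length-++-∷ (false ∷ v′) true false (ones t)) (trans (cong length (sym α≡′)) |α|≡n)
        γ-min = flipLastZero-RotationMinimal t v′ (subst RotationMinimal α≡′ min)
        γ-below = flipLastZero-StrictlyBelowReversal t v′ (notPalindrome++ones v₁ t t∈ α≡v) (subst StrictlyBelowReversal α≡′ below)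

      lastOne-lastZero-α-InA : ∀ v₁ t → (t ≡ 1 ⊎ t ≡ 2) → α ≡ zeros J ++ true ∷ v₁ ++ false ∷ ones t →
                              InA n (lastOne (lastZero α))
      lastOne-lastZero-α-InA v₁ zero (inj₁ ()) _
      lastOne-lastZero-α-InA v₁ zero (inj₂ ()) _
      lastOne-lastZero-α-InA v₁ (suc t) t∈ α≡v =
        subst (InA n ∘ lastOne ∘ lastZero) (sym α≡v)
          (lastOne-lastZero-InA j v₁ t (trans (cong length (sym α≡v)) |α|≡n) (subst (NoZeroRun (suc J)) α≡v noRun)
            (subst StrictlyBelowReversal α≡v below) (notOnes v₁ (suc t) t∈ α≡v))

      conclusion : ((∃[ β ] α ≡ β ++ false ∷ true ∷ true ∷ []) ⊎ (∃[ β ] α ≡ β ++ false ∷ true ∷ []))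
                   × InA n (lastZero α) × InA n (lastOne (lastZero α))
      conclusion with ending
      ... | v₁ , t , t∈ , α≡v = lastZeroPosition t∈ , lastZero-α-InA v₁ t t∈ α≡v , lastOne-lastZero-α-InA v₁ t t∈ α≡v
        where
        α≡β : α ≡ (zeros J ++ true ∷ v₁) ++ false ∷ ones t
        α≡β = trans α≡v (sym (++-assoc (zeros J) (true ∷ v₁) (false ∷ ones t)))
        lastZeroPosition : (t ≡ 1 ⊎ t ≡ 2) → (∃[ β ] α ≡ β ++ false ∷ true ∷ true ∷ []) ⊎ (∃[ β ] α ≡ β ++ false ∷ true ∷ [])
        lastZeroPosition (inj₁ refl) = inj₂ (zeros J ++ true ∷ v₁ , α≡β)
        lastZeroPosition (inj₂ refl) = inj₁ (zeros J ++ true ∷ v₁ , α≡β)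

lemma2 : (n : ℕ) → 6 ≤ n → (α : Str) → InA n α → α ≢ r n
    → ¬ InA n (firstOne α) → ¬ InA n (lastOne α)
    → ((∃[ β ] α ≡ β ++ false ∷ true ∷ true ∷ []) ⊎ (∃[ β ] α ≡ β ++ false ∷ true ∷ []))
    × InA n (lastZero α) × InA n (lastOne (lastZero α))
lemma2 n 6≤n α α∈A α≢r firstOne∉A lastOne∉A =
  let _ , _ , _ , α≡ = shape 0<n α∈A firstOne∉A in conclusion 0<n α∈A firstOne∉A α≢r lastOne∉A α≡
  where
  0<n : 0 < n
  0<n = ≤-trans (s≤s z≤n) 6≤n
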